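{- Let $n\ge2$, fix $(i,j)$ with $1\le i\le j\le n$, and $w\in B_n$. Then \[\sum_{T:\ (w,T)\in\mathcal A(\Phi_{ij})} t^{\frac12(\ell(w)+\ell(wT)-|T|)}(1-t)^{|T|}=t^{\ell_+(w)+\ell_-^{ij}(w)}.\] In particular, when the sum is over $(w,T)\in\mathcal A(\Phi)$, the right-hand side is $t^{\ell_+(w)}$.
   Context: $[\bar n]=\{1<\cdots<n<\bar n<\cdots<\bar1\}$ totally ordered, $\bar{\bar\imath}=i$; $B_n$ = bijections $w$ of $[\bar n]$ with $w(\bar\imath)=\overline{w(i)}$, window $w(1)\cdots w(n)$. For $1\le k<l\le n$, reflection $(k,\bar l)$ acts by right multiplication swapping positions $k,l$ and barring both entries; $(k,\bar k)$ bars the entry in position $k$. $\ell_+(w)=|\{(k,l):1\le k<l\le n,\ w(k)>w(l)\}|$, $\ell_-(w)=|\{(k,l):1\le k\le l\le n,\ w(k)>\overline{w(l)}\}|$, $\ell(w)=\ell_+(w)+\ell_-(w)$. Bruhat order: transitive closure of $u<us$ for reflections $s$ of $B_n$ with $\ell(us)>\ell(u)$. Let $\Phi$ be the sequence $((1,\bar1),\,(1,\bar2),(2,\bar2),\,(1,\bar3),(2,\bar3),(3,\bar3),\ldots,(1,\bar n),\ldots,(n,\bar n))$, i.e. the pairs $(k,\bar l)$, $1\le k\le l\le n$, ordered by $l$ and then by $k$; $\Phi_{ij}$ is the final segment of $\Phi$ starting at $(i,\bar\jmath)$ (so $\Phi_{11}=\Phi$). For a sequence of reflections $\Delta=(\delta_1,\ldots,\delta_M)$,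 $\mathcal A(\Delta)$ is the set of pairs $(w,T)$ with $w\in B_n$ and $T=(\delta_{j_1},\ldots,\delta_{j_s})$, $j_1<\cdots<j_s$, such that $w>w\delta_{j_1}>\cdots>w\delta_{j_1}\cdots\delta_{j_s}=:wT$ in Bruhat order (not necessarily covers); $|T|=s$. Finally $\ell_-^{ij}(w)=|\{(k,l):(k,\bar l)\in\Phi\setminus\Phi_{ij},\ w(k)>\overline{w(l)}\}|$. -}

module Defs where

open import Level using (Level)
open import Data.Bool using (Bool; true; false; not; _∧_; _∨_; if_then_else_)
import Data.Nat as ℕ
open import Data.Nat using (ℕ; zero; suc; _∸_; _<_; _≤_; _<ᵇ_; _≡ᵇ_; _/_)
open import Data.Fin using (Fin; toℕ)
open import Data.Product using (_×_; _,_; proj₁; proj₂)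
open import Data.List using (List; []; _∷_; length; map; filterᵇ; allFin; cartesianProduct; concatMap; foldl; foldr)
open import Data.List.Relation.Binary.Sublist.Propositional using (_⊆_)
open import Data.Vec using (Vec; lookup; _[_]≔_)
open import Data.Unit using (⊤)
open import Relation.Binary.PropositionalEquality using (_≡_)
open import Algebra.Bundles using (CommutativeRing)

-- Conventions: positions 1..n and values 1..n are encoded 0-indexed by
-- Fin n.  A value of [n̄] is a pair (i , b): b = false means i, b = true
-- means ī.

record Val (n : ℕ) : Set where
  constructor val
  field
    idx    : Fin n
    barred : Bool
open Val public

bar : ∀ {n} → Val n → Val n
bar (val i b) = val i (not b)

-- Total order 1 < ... < n < n̄ < ... < 1̄ on [n̄], via a ℕ-valued key
-- (0-indexed i ↦ i, barred i ↦ 2n-1-i).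
key : ∀ {n} → Val n → ℕ
key {n} (val i false) = toℕ i
key {n} (val i true)  = n ℕ.+ (n ∸ suc (toℕ i))

_>ᵛ_ : ∀ {n} → Val n → Val n → Bool
u >ᵛ v = key v <ᵇ key u

-- An element of B_n is given by its window w(1)…w(n); the condition is
-- that |w(1)|,…,|w(n)| are distinct (hence a permutation of 1..n).
Window : ℕ → Set
Window n = Vec (Val n) n

IsSignedPerm : ∀ {n} → Window n → Set
IsSignedPerm {n} w = ∀ (k l : Fin n) → idx (lookup w k) ≡ idx (lookup w l) → k ≡ l

actTr : ∀ {n} → Window n → Fin n → Fin n → Window n
actTr w k l = (w [ k ]≔ lookup w l) [ l ]≔ lookup w k

-- (k, l̄), k ≤ l: swap positions k, l and bar both (k = l: bar position k)
actBar : ∀ {n} → Window n → Fin n → Fin n → Window n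
actBar w k l = (w [ k ]≔ bar (lookup w l)) [ l ]≔ bar (lookup w k)

-- A barred reflection (k, l̄) is recorded as the pair (k , l).
BRefl : ℕ → Set
BRefl n = Fin n × Fin n

actB : ∀ {n} → Window n → BRefl n → Window n
actB w (k , l) = actBar w k l

pairs : ∀ n → List (Fin n × Fin n)
pairs n = cartesianProduct (allFin n) (allFin n)

count : ∀ {n} → (Fin n × Fin n → Bool) → ℕ
count {n} p = length (filterᵇ p (pairs n))

ℓ₊ : ∀ {n} → Window n → ℕ
ℓ₊ w = count (λ { (k , l) → (toℕ k <ᵇ toℕ l) ∧ (lookup w k >ᵛ lookup w l) })

_≤ᵇ_ : ℕ → ℕ → Bool
a ≤ᵇ b = a <ᵇ suc b

ℓ₋ : ∀ {n} → Window n → ℕ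
ℓ₋ w = count (λ { (k , l) → (toℕ k ≤ᵇ toℕ l) ∧ (lookup w k >ᵛ bar (lookup w l)) })

len : ∀ {n} → Window n → ℕ
len w = ℓ₊ w ℕ.+ ℓ₋ w

data _<B_ {n : ℕ} : Window n → Window n → Set where
  stepTr  : ∀ u (k l : Fin n) → toℕ k < toℕ l → len u < len (actTr u k l)
          → u <B actTr u k l
  stepBar : ∀ u (k l : Fin n) → toℕ k ≤ toℕ l → len u < len (actBar u k l)
          → u <B actBar u k l
  trans<B : ∀ {u v x} → u <B v → v <B x → u <B x

-- The sequence Φ = ((1,1̄),(1,2̄),(2,2̄),(1,3̄),…,(n,n̄)), ordered by l then k.

Φ : ∀ n → List (BRefl n)
Φ n = concatMap (λ l → map (λ k → (k , l)) (filterᵇ (λ k → toℕ k ≤ᵇ toℕ l) (allFin n)))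
                (allFin n)

-- (k,l̄) strictly precedes (i,j̄) in Φ
before : ∀ {n} → Fin n → Fin n → BRefl n → Bool
before i j (k , l) = (toℕ l <ᵇ toℕ j) ∨ ((toℕ l ≡ᵇ toℕ j) ∧ (toℕ k <ᵇ toℕ i))

Φseg : ∀ n → Fin n → Fin n → List (BRefl n)
Φseg n i j = filterᵇ (λ r → not (before i j r)) (Φ n)

ℓ₋ij : ∀ {n} → Fin n → Fin n → Window n → ℕ
ℓ₋ij {n} i j w =
  length (filterᵇ (λ { (k , l) → lookup w k >ᵛ bar (lookup w l) })
                  (filterᵇ (before i j) (Φ n)))

Chain : ∀ {n} → Window n → List (BRefl n) → Set
Chain w []      = ⊤
Chain w (s ∷ T) = (actB w s <B w) × Chain (actB w s) T

InA : ∀ {n} → List (BRefl n) → Window n → List (BRefl n) → Set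
InA Δ w T = (T ⊆ Δ) × Chain w T

actList : ∀ {n} → Window n → List (BRefl n) → Window n
actList w T = foldl actB w T

module Sum {c ℓ : Level} (R : CommutativeRing c ℓ) where
  open CommutativeRing R using (Carrier; _*_; _+_; _-_; 0#; 1#)

  pow : Carrier → ℕ → Carrier
  pow x zero    = 1#
  pow x (suc m) = x * pow x m

  expo : ∀ {n} → Window n → List (BRefl n) → ℕ
  expo w T = ((len w ℕ.+ len (actList w T)) ∸ length T) / 2

  term : ∀ {n} → Carrier → Window n → List (BRefl n) → Carrier
  term t w T = pow t (expo w T) * pow (1# - t) (length T)

  sumOver : ∀ {n} → Carrier → Window n → List (List (BRefl n)) → Carrier
  sumOver t w L = foldr (λ T acc → term t w T + acc) 0# L

-- Every T with (w, T) ∈ 𝒜(Δ), Δ a final segment of Φ with first element δ = (i, j̄), either avoids δ, or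
-- starts with δ and continues from w' = w(i, j̄) inside the rest of Δ. So one proves, by induction along Δ,
-- that the sum equals t^e whenever e + #{(k, l̄) ∈ Δ : w(k) > bar(w(l))} = ℓ(w). If w(i) < bar(w(j)), no T starts
-- with δ, since then w' lies above w. If w(i) > bar(w(j)), the heart of the matter is the length identity
--   ℓ(w) + 2 N(w') = ℓ(w') + 1 + 2 N(w)  and  N(w') ≤ N(w),
-- N counting the pairs (k, l̄) after δ in Φ with w(k) > bar(w(l)). Writing ℓ(w) = ℓ(w') + 2m + 1, the chains
-- avoiding δ contribute t^(e+1) and those through w' contribute t^m (1 − t) t^(e−m), which add up to t^e.
-- The length identity is verified pair of positions by pair of positions: pairs avoiding i and j are
-- unaffected, and the pairs meeting {i, j} are grouped so that a case analysis on the relative order of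
-- the values involved settles each group.

module Submission where

open import Defs
open import Level using (Level; _⊔_)
open import Data.Bool using (Bool; true; false; not; _∧_; if_then_else_; T)
open import Data.Bool.Properties using (T-≡; T-not-≡; T-∧; T-∨; not-¬)
import Data.Nat as ℕ
open ℕ using (ℕ; zero; suc)
open import Data.Fin using (Fin; toℕ) renaming (zero to fzero; suc to fsuc)
import Data.Fin.Properties as Fin
open import Data.Fin.Permutation.Components using (transpose; transpose-inverse)
open import Data.Product using (_×_; _,_; proj₁; proj₂; Σ-syntax; ∃)
open import Data.Product.Properties using (≡-dec)
open import Data.Sum using (_⊎_; inj₁; inj₂)
open import Data.Empty using (⊥-elim)
open import Data.Vec using (Vec; lookup; _[_]≔_)
open import Data.Vec.Properties using (lookup∘update; lookup∘update′; tabulate∘lookup; tabulate-cong)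
open import Data.List using (List; []; _∷_; _++_; length; map; filterᵇ; tabulate; allFin; cartesianProduct)
open import Data.List.Properties using (map-tabulate)
open import Data.List.Membership.Propositional using (_∈_; _∉_)
open import Data.List.Membership.Propositional.Properties
  using (∈-filter⁺; ∈-filter⁻; ∈-allFin; ∈-cartesianProduct⁺; ∈-map⁺; ∈-map⁻; ∈-concat⁺′; ∈-concat⁻′)
open import Data.List.Membership.Propositional.Properties.WithK using (unique∧set⇒bag)
open import Data.List.Relation.Unary.Any using (any?; here; there)
open import Data.List.Relation.Unary.All using (All; []; _∷_)
import Data.List.Relation.Unary.All as All
open import Data.List.Relation.Unary.AllPairs using (AllPairs; []; _∷_)
import Data.List.Relation.Unary.AllPairs as AllPairs
import Data.List.Relation.Unary.AllPairs.Properties as AllPairs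
open import Data.List.Relation.Unary.Unique.Propositional using (Unique)
import Data.List.Relation.Unary.Unique.Propositional.Properties as Unique
open import Data.List.Relation.Binary.Sublist.Propositional using (_⊆_; []; _∷_; _∷ʳ_)
import Data.List.Relation.Binary.Sublist.Propositional as Sublist
open import Data.List.Relation.Binary.BagAndSetEquality using (∼bag⇒↭)
open import Data.List.Relation.Binary.Permutation.Propositional using (_↭_)
open import Data.List.Relation.Binary.Permutation.Propositional.Properties using (↭-length; filter-↭)
open import Function using (_∘_)
open import Function.Bundles using (Equivalence; _⇔_; mk⇔)
open import Relation.Nullary using (Dec; does; yes; no; ¬_)
open import Relation.Nullary.Decidable using (T?)
open import Relation.Nullary.Reflects using (ofⁿ; det; fromEquivalence; T-reflects-elim)
open import Relation.Binary.PropositionalEquality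
open import Relation.Binary.Definitions using (tri<; tri≈; tri>; DecidableEquality)
open import Algebra.Bundles using (CommutativeRing)

module Combinatorics where
  open import Data.Nat using (_+_; _*_; _∸_; _<_; _≤_; _<ᵇ_; _≡ᵇ_; z≤n; s≤s)
  open import Data.Nat.Properties
  open import Data.Nat.Divisibility using (divides)
  open import Data.Nat.DivMod using (_/_; m*n/n≡m; +-distrib-/-∣ˡ)
  open import Data.Nat.Tactic.RingSolver using (solve-∀)
  open import Algebra.Properties.CommutativeSemigroup +-commutativeSemigroup using (x∙yz≈y∙xz; interchange)
  open import Algebra.Properties.CommutativeMonoid.Sum +-0-commutativeMonoid
    using (sum; sum-cong-≗; ∑-distrib-+; sum-replicate-zero)
  open import Algebra.Properties.Semiring.Sum +-*-semiring using (*-distribˡ-sum)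

  T-injective : ∀ {a b : Bool} → (T a → T b) → (T b → T a) → a ≡ b
  T-injective f g = T-reflects-elim (fromEquivalence f g)

  ¬T⇒T-not : ∀ {b} → ¬ T b → T (not b)
  ¬T⇒T-not {false} _ = _
  ¬T⇒T-not {true}  ¬b = ¬b _

  T-not⇒¬T : ∀ {b} → T (not b) → ¬ T b
  T-not⇒¬T {false} _ ()
  T-not⇒¬T {true}  ()

  <ᵇ-true : ∀ {m n} → m < n → (m <ᵇ n) ≡ true
  <ᵇ-true m<n = Equivalence.to T-≡ (<⇒<ᵇ m<n)

  <ᵇ-false : ∀ {m n} → ¬ m < n → (m <ᵇ n) ≡ false
  <ᵇ-false {m} {n} m≮n = det (<ᵇ-reflects-< m n) (ofⁿ m≮n)

  <ᵇ-flip : ∀ {m n} → m ≢ n → (n <ᵇ m) ≡ not (m <ᵇ n)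
  <ᵇ-flip {m} {n} m≢n with <-cmp m n
  ... | tri< m<n _ n≮m = trans (<ᵇ-false n≮m) (cong not (sym (<ᵇ-true m<n)))
  ... | tri≈ _ m≡n _   = ⊥-elim (m≢n m≡n)
  ... | tri> m≮n _ n<m = trans (<ᵇ-true n<m) (cong not (sym (<ᵇ-false m≮n)))

  ≡ᵇ-refl : ∀ m → (m ≡ᵇ m) ≡ true
  ≡ᵇ-refl m = Equivalence.to T-≡ (≡⇒≡ᵇ m m refl)

  ≡ᵇ-false : ∀ {m n} → m ≢ n → (m ≡ᵇ n) ≡ false
  ≡ᵇ-false {m} {n} m≢n = T-injective (λ eq → ⊥-elim (m≢n (≡ᵇ⇒≡ m n eq))) λ ()

  +-cross-< : ∀ {a b c d} → a + b ≡ c + d → a < c → d < b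
  +-cross-< {a} {b} {c} {d} eq a<c with <-cmp d b
  ... | tri< d<b _ _ = d<b
  ... | tri≈ _ d≡b _ = ⊥-elim (<-irrefl eq (+-mono-<-≤ a<c (≤-reflexive (sym d≡b))))
  ... | tri> _ _ b<d = ⊥-elim (<-irrefl eq (+-mono-< a<c b<d))

  <ᵇ-cross : ∀ {a b c d} → a + b ≡ c + d → (a <ᵇ c) ≡ (d <ᵇ b)
  <ᵇ-cross {a} {b} {c} {d} eq = T-injective
    (λ h → <⇒<ᵇ (+-cross-< eq (<ᵇ⇒< a c h)))
    (λ h → <⇒<ᵇ (+-cross-< (trans (+-comm d c) (trans (sym eq) (+-comm a b))) (<ᵇ⇒< d b h)))

  bar-involutive : ∀ {n} (u : Val n) → bar (bar u) ≡ u
  bar-involutive (val i false) = refl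
  bar-involutive (val i true)  = refl

  key+key∘bar : ∀ {n} (u : Val n) → key u + key (bar u) ≡ n + (n ∸ 1)
  key+key∘bar {suc n} (val i false) =
    trans (x∙yz≈y∙xz (toℕ i) (suc n) (n ∸ toℕ i)) (cong (suc n +_) (m+[n∸m]≡n (Fin.toℕ≤pred[n] i)))
  key+key∘bar {suc n} (val i true) = trans (+-comm _ (toℕ i)) (key+key∘bar (val i false))

  key-injective : ∀ {n} {u v : Val n} → key u ≡ key v → u ≡ v
  key-injective {n} {val i false} {val k false} eq = cong (λ z → val z false) (Fin.toℕ-injective eq)
  key-injective {n} {val i false} {val k true}  eq = ⊥-elim (<-irrefl eq (<-≤-trans (Fin.toℕ<n i) (m≤m+n n _)))
  key-injective {n} {val i true}  {val k false} eq = ⊥-elim (<-irrefl (sym eq) (<-≤-trans (Fin.toℕ<n k) (m≤m+n n _)))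
  key-injective {n} {val i true}  {val k true}  eq = cong (λ z → val (idx z) true) (key-injective {u = val i false} {val k false}
    (+-cancelʳ-≡ _ _ _ (trans (key+key∘bar (val i false)) (trans (sym (key+key∘bar (val k false))) (cong (toℕ k +_) (sym eq))))))

  key-bar-≢ : ∀ {n} (u : Val n) → key u ≢ key (bar u)
  key-bar-≢ u eq = not-¬ refl (cong barred (key-injective {u = u} {bar u} eq))

  bar-antitone : ∀ {n} (u v : Val n) → (bar u >ᵛ bar v) ≡ (v >ᵛ u)
  bar-antitone u v = <ᵇ-cross {key (bar v)} {key v} {key (bar u)} {key u} (trans (+-comm _ (key v)) (trans (key+key∘bar v) (sym (trans (+-comm _ (key u)) (key+key∘bar u)))))

  >ᵛ-bar-comm : ∀ {n} (u v : Val n) → (u >ᵛ bar v) ≡ (v >ᵛ bar u)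
  >ᵛ-bar-comm u v = <ᵇ-cross {key (bar v)} {key v} {key u} {key (bar u)} (trans (+-comm _ (key v)) (trans (key+key∘bar v) (sym (key+key∘bar u))))

  >ᵛ-flip : ∀ {n} (u v : Val n) → key u ≢ key v → (v >ᵛ u) ≡ not (u >ᵛ v)
  >ᵛ-flip u v ne = <ᵇ-flip (λ e → ne (sym e))

  >ᵛ-trans : ∀ {n} {u v x : Val n} → T (u >ᵛ v) → T (v >ᵛ x) → T (u >ᵛ x)
  >ᵛ-trans {u = u} {v} {x} u>v v>x = <⇒<ᵇ (<-trans (<ᵇ⇒< (key x) (key v) v>x) (<ᵇ⇒< (key v) (key u) u>v))

  -- Finite double sums

  χ : Bool → ℕ
  χ b = if b then 1 else 0

  Σ₂ : ∀ {n} → (Fin n → Fin n → ℕ) → ℕ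
  Σ₂ H = sum (λ p → sum (H p))

  sum-mono-≤ : ∀ {n} {f g : Fin n → ℕ} → (∀ p → f p ≤ g p) → sum f ≤ sum g
  sum-mono-≤ {zero}  f≤g = z≤n
  sum-mono-≤ {suc n} f≤g = +-mono-≤ (f≤g fzero) (sum-mono-≤ (λ p → f≤g (fsuc p)))

  except : ∀ {n} → Fin n → (Fin n → ℕ) → Fin n → ℕ
  except i f p = if does (p Fin.≟ i) then 0 else f p

  sum-except : ∀ {n} (i : Fin n) (f : Fin n → ℕ) → sum f ≡ f i + sum (except i f)
  sum-except fzero    f = refl
  sum-except (fsuc i) f = trans (cong (f fzero +_) (sum-except i (λ p → f (fsuc p))))
                                (x∙yz≈y∙xz (f fzero) (f (fsuc i)) _)

  sumOf : ∀ {n} → List (Fin n) → (Fin n → ℕ) → ℕ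
  sumOf []      f = 0
  sumOf (i ∷ S) f = f i + sumOf S f

  _∈?_ : ∀ {n} (p : Fin n) (S : List (Fin n)) → Dec (p ∈ S)
  p ∈? S = any? (p Fin.≟_) S

  outside : ∀ {n} → List (Fin n) → (Fin n → ℕ) → Fin n → ℕ
  outside S f p = if does (p ∈? S) then 0 else f p

  sumOf-cong : ∀ {n} (S : List (Fin n)) {f g : Fin n → ℕ} → (∀ p → f p ≡ g p) → sumOf S f ≡ sumOf S g
  sumOf-cong []      f≗g = refl
  sumOf-cong (i ∷ S) f≗g = cong₂ _+_ (f≗g i) (sumOf-cong S f≗g)

  sumOf-+ : ∀ {n} (S : List (Fin n)) (f g : Fin n → ℕ) → sumOf S (λ p → f p + g p) ≡ sumOf S f + sumOf S g
  sumOf-+ []      f g = refl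
  sumOf-+ (i ∷ S) f g = trans (cong (f i + g i +_) (sumOf-+ S f g)) (interchange (f i) (g i) _ _)

  sumOf-except : ∀ {n} {i : Fin n} (S : List (Fin n)) (f : Fin n → ℕ) → All (i ≢_) S → sumOf S (except i f) ≡ sumOf S f
  sumOf-except []      f []           = refl
  sumOf-except {i = i} (k ∷ S) f (i≢k ∷ i∉S) with k Fin.≟ i
  ... | yes k≡i = ⊥-elim (i≢k (sym k≡i))
  ... | no  _   = cong (f k +_) (sumOf-except S f i∉S)

  outside-∷ : ∀ {n} (i : Fin n) S f p → outside (i ∷ S) f p ≡ outside S (except i f) p
  outside-∷ i S f p with p Fin.≟ i | p ∈? S
  ... | yes _ | yes _ = refl
  ... | yes _ | no  _ = refl
  ... | no  _ | yes _ = refl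
  ... | no  _ | no  _ = refl

  sum-outside : ∀ {n} {S : List (Fin n)} → Unique S → (f : Fin n → ℕ) → sum f ≡ sumOf S f + sum (outside S f)
  sum-outside []                       f = refl
  sum-outside {S = i ∷ S} (i∉S ∷ uniq) f = begin
    sum f                                                 ≡⟨ sum-except i f ⟩
    f i + sum (except i f)                                ≡⟨ cong (f i +_) (sum-outside uniq (except i f)) ⟩
    f i + (sumOf S (except i f) + sum (outside S (except i f)))
      ≡⟨ cong₂ (λ a b → f i + (a + b)) (sumOf-except S f i∉S) (sym (sum-cong-≗ (outside-∷ i S f))) ⟩
    f i + (sumOf S f + sum (outside (i ∷ S) f))           ≡⟨ sym (+-assoc (f i) _ _) ⟩
    sumOf (i ∷ S) f + sum (outside (i ∷ S) f)             ∎
    where open ≡-Reasoning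

  outside-+ : ∀ {n} S (f g : Fin n → ℕ) p → outside S (λ q → f q + g q) p ≡ outside S f p + outside S g p
  outside-+ S f g p with does (p ∈? S)
  ... | true  = refl
  ... | false = refl

  sumOf-zero : ∀ {n} (S : List (Fin n)) → sumOf S (λ _ → 0) ≡ 0
  sumOf-zero []      = refl
  sumOf-zero (i ∷ S) = sumOf-zero S

  outside-sumOf : ∀ {n} S S' (g : Fin n → Fin n → ℕ) q →
    outside S (λ q → sumOf S' (λ p → g p q)) q ≡ sumOf S' (λ p → outside S (g p) q)
  outside-sumOf S S' g q with does (q ∈? S)
  ... | true  = sym (sumOf-zero S')
  ... | false = refl

  sum-sumOf-comm : ∀ {n} S (g : Fin n → Fin n → ℕ) → sum (λ q → sumOf S (λ p → g p q)) ≡ sumOf S (λ p → sum (g p))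
  sum-sumOf-comm {n} []      g = sum-replicate-zero n
  sum-sumOf-comm (i ∷ S) g = trans (∑-distrib-+ (g i) (λ q → sumOf S (λ p → g p q))) (cong (sum (g i) +_) (sum-sumOf-comm S g))

  sum-outside-mono : ∀ {n} S {f g : Fin n → ℕ} → (∀ q → q ∉ S → f q ≤ g q) → sum (outside S f) ≤ sum (outside S g)
  sum-outside-mono S {f} {g} f≤g = sum-mono-≤ pointwise
    where
    pointwise : ∀ q → outside S f q ≤ outside S g q
    pointwise q with q ∈? S
    ... | yes _   = z≤n
    ... | no  q∉S = f≤g q q∉S

  sum-outside-cong : ∀ {n} S {f g : Fin n → ℕ} → (∀ q → q ∉ S → f q ≡ g q) → sum (outside S f) ≡ sum (outside S g)
  sum-outside-cong S {f} {g} f≗g = sum-cong-≗ pointwise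
    where
    pointwise : ∀ q → outside S f q ≡ outside S g q
    pointwise q with q ∈? S
    ... | yes _   = refl
    ... | no  q∉S = f≗g q q∉S

  block : ∀ {n} → List (Fin n) → (Fin n → Fin n → ℕ) → ℕ
  block S H = sumOf S (λ p → sumOf S (H p))

  cross : ∀ {n} → List (Fin n) → (Fin n → Fin n → ℕ) → Fin n → ℕ
  cross S H q = sumOf S (λ p → H p q + H q p)

  rest : ∀ {n} → List (Fin n) → (Fin n → Fin n → ℕ) → ℕ
  rest S H = sum (outside S (λ p → sum (outside S (H p))))

  Σ₂-decompose : ∀ {n} {S : List (Fin n)} → Unique S → (H : Fin n → Fin n → ℕ) →
    Σ₂ H ≡ block S H + sum (outside S (cross S H)) + rest S H
  Σ₂-decompose {S = S} uniq H = begin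
    Σ₂ H                                    ≡⟨ sum-outside uniq (λ p → sum (H p)) ⟩
    sumOf S (λ p → sum (H p)) + sum (outside S (λ p → sum (H p)))
      ≡⟨ cong₂ _+_ (trans (sumOf-cong S (λ p → sum-outside uniq (H p))) (sumOf-+ S _ _))
                   (trans (sum-outside-cong S (λ p _ → sum-outside uniq (H p)))
                          (trans (sum-cong-≗ (outside-+ S (λ p → sumOf S (H p)) (λ p → sum (outside S (H p)))))
                                 (∑-distrib-+ (outside S (λ p → sumOf S (H p))) (outside S (λ p → sum (outside S (H p))))))) ⟩
    (block S H + rowOut) + (colOut + rest S H)  ≡⟨ regroup (block S H) rowOut colOut (rest S H) ⟩
    block S H + (rowOut + colOut) + rest S H    ≡⟨ cong (λ x → block S H + x + rest S H) (sym crossSum) ⟩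
    block S H + sum (outside S (cross S H)) + rest S H ∎
    where
    open ≡-Reasoning
    rowOut colOut : ℕ
    rowOut = sumOf S (λ p → sum (outside S (H p)))
    colOut = sum (outside S (λ p → sumOf S (H p)))
    regroup : ∀ a b c d → a + b + (c + d) ≡ a + (b + c) + d
    regroup = solve-∀
    crossSum : sum (outside S (cross S H)) ≡ rowOut + colOut
    crossSum = begin
      sum (outside S (cross S H))
        ≡⟨ sum-outside-cong S (λ q _ → sumOf-+ S (λ p → H p q) (H q)) ⟩
      sum (outside S (λ q → sumOf S (λ p → H p q) + sumOf S (H q)))
        ≡⟨ trans (sum-cong-≗ (outside-+ S (λ q → sumOf S (λ p → H p q)) (λ q → sumOf S (H q))))
                 (∑-distrib-+ (outside S (λ q → sumOf S (λ p → H p q))) (outside S (λ q → sumOf S (H q)))) ⟩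
      sum (outside S (λ q → sumOf S (λ p → H p q))) + colOut
        ≡⟨ cong (_+ colOut) (trans (sum-cong-≗ (outside-sumOf S S H)) (sum-sumOf-comm S (λ p → outside S (H p)))) ⟩
      rowOut + colOut ∎

  Σ₂-≡-suc : ∀ {n} {S : List (Fin n)} → Unique S → {L R : Fin n → Fin n → ℕ} →
    block S L ≡ suc (block S R) → (∀ q → q ∉ S → cross S L q ≡ cross S R q) →
    (∀ p q → p ∉ S → q ∉ S → L p q ≡ R p q) → Σ₂ L ≡ suc (Σ₂ R)
  Σ₂-≡-suc {S = S} uniq {L} {R} blk crs rst = begin
    Σ₂ L                                                  ≡⟨ Σ₂-decompose uniq L ⟩
    block S L + sum (outside S (cross S L)) + rest S L
      ≡⟨ cong₂ _+_ (cong₂ _+_ blk (sum-outside-cong S crs))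
                   (sum-outside-cong S (λ p p∉S → sum-outside-cong S (λ q q∉S → rst p q p∉S q∉S))) ⟩
    suc (block S R) + sum (outside S (cross S R)) + rest S R ≡⟨ cong suc (sym (Σ₂-decompose uniq R)) ⟩
    suc (Σ₂ R) ∎
    where open ≡-Reasoning

  Σ₂-mono : ∀ {n} {S : List (Fin n)} → Unique S → {L R : Fin n → Fin n → ℕ} →
    block S L ≤ block S R → (∀ q → q ∉ S → cross S L q ≤ cross S R q) →
    (∀ p q → p ∉ S → q ∉ S → L p q ≤ R p q) → Σ₂ L ≤ Σ₂ R
  Σ₂-mono {S = S} uniq {L} {R} blk crs rst = begin
    Σ₂ L                                                  ≡⟨ Σ₂-decompose uniq L ⟩
    block S L + sum (outside S (cross S L)) + rest S L
      ≤⟨ +-mono-≤ (+-mono-≤ blk (sum-outside-mono S crs))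
                  (sum-outside-mono S (λ p p∉S → sum-outside-mono S (λ q q∉S → rst p q p∉S q∉S))) ⟩
    block S R + sum (outside S (cross S R)) + rest S R    ≡⟨ Σ₂-decompose uniq R ⟨
    Σ₂ R ∎
    where open ≤-Reasoning

  -- The reflections (k, l̄) on windows

  Vec-ext : ∀ {A : Set} {n} {u v : Vec A n} → (∀ p → lookup u p ≡ lookup v p) → u ≡ v
  Vec-ext {u = u} {v} u≗v = trans (sym (tabulate∘lookup u)) (trans (tabulate-cong u≗v) (tabulate∘lookup v))

  module _ {n} (w : Window n) (i j : Fin n) where

    lookup-actBar-j : lookup (actBar w i j) j ≡ bar (lookup w i)
    lookup-actBar-j = lookup∘update j (w [ i ]≔ bar (lookup w j)) (bar (lookup w i))

    lookup-actBar-i : lookup (actBar w i j) i ≡ bar (lookup w j)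
    lookup-actBar-i with i Fin.≟ j
    ... | yes refl = lookup-actBar-j
    ... | no  i≢j  = trans (lookup∘update′ i≢j (w [ i ]≔ bar (lookup w j)) (bar (lookup w i)))
                           (lookup∘update i w (bar (lookup w j)))

    lookup-actBar-other : ∀ {p} → p ≢ i → p ≢ j → lookup (actBar w i j) p ≡ lookup w p
    lookup-actBar-other p≢i p≢j = trans (lookup∘update′ p≢j (w [ i ]≔ bar (lookup w j)) (bar (lookup w i)))
                                        (lookup∘update′ p≢i w (bar (lookup w j)))

    idx-actBar : ∀ p → idx (lookup (actBar w i j) p) ≡ idx (lookup w (transpose i j p))
    idx-actBar p with p Fin.≟ i
    ... | yes refl = cong idx lookup-actBar-i
    ... | no  p≢i with p Fin.≟ j
    ...   | yes refl = cong idx lookup-actBar-j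
    ...   | no  p≢j  = cong idx (lookup-actBar-other p≢i p≢j)

    actBar-signed : IsSignedPerm w → IsSignedPerm (actBar w i j)
    actBar-signed signed k l eq = begin
      k                                  ≡⟨ transpose-inverse j i ⟨
      transpose j i (transpose i j k)    ≡⟨ cong (transpose j i) (signed _ _ (trans (sym (idx-actBar k)) (trans eq (idx-actBar l)))) ⟩
      transpose j i (transpose i j l)    ≡⟨ transpose-inverse j i ⟩
      l                                  ∎
      where open ≡-Reasoning

  actBar-involutive : ∀ {n} (w : Window n) (i j : Fin n) → actBar (actBar w i j) i j ≡ w
  actBar-involutive w i j = Vec-ext pointwise
    where
    w' = actBar w i j
    pointwise : ∀ p → lookup (actBar w' i j) p ≡ lookup w p
    pointwise p with p Fin.≟ j
    ... | yes refl = trans (lookup-actBar-j w' i p) (trans (cong bar (lookup-actBar-i w i p)) (bar-involutive _))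
    ... | no  p≢j with p Fin.≟ i
    ...   | yes refl = trans (lookup-actBar-i w' p j) (trans (cong bar (lookup-actBar-j w p j)) (bar-involutive _))
    ...   | no  p≢i  = trans (lookup-actBar-other w' i j p≢i p≢j) (lookup-actBar-other w i j p≢i p≢j)

  countBy : ∀ {A : Set} → (A → Bool) → List A → ℕ
  countBy P xs = length (filterᵇ P xs)

  countBy-∷ : ∀ {A : Set} (P : A → Bool) x xs → countBy P (x ∷ xs) ≡ χ (P x) + countBy P xs
  countBy-∷ P x xs with P x
  ... | true  = refl
  ... | false = refl

  countBy-++ : ∀ {A : Set} (P : A → Bool) xs ys → countBy P (xs ++ ys) ≡ countBy P xs + countBy P ys
  countBy-++ P []       ys = refl
  countBy-++ P (x ∷ xs) ys = begin
    countBy P (x ∷ xs ++ ys)              ≡⟨ countBy-∷ P x (xs ++ ys) ⟩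
    χ (P x) + countBy P (xs ++ ys)        ≡⟨ cong (χ (P x) +_) (countBy-++ P xs ys) ⟩
    χ (P x) + (countBy P xs + countBy P ys) ≡⟨ +-assoc (χ (P x)) _ _ ⟨
    χ (P x) + countBy P xs + countBy P ys ≡⟨ cong (_+ countBy P ys) (countBy-∷ P x xs) ⟨
    countBy P (x ∷ xs) + countBy P ys     ∎
    where open ≡-Reasoning

  countBy-tabulate : ∀ {A : Set} {n} (P : A → Bool) (f : Fin n → A) → countBy P (tabulate f) ≡ sum (λ q → χ (P (f q)))
  countBy-tabulate {n = zero}  P f = refl
  countBy-tabulate {n = suc n} P f =
    trans (countBy-∷ P (f fzero) _) (cong (χ (P (f fzero)) +_) (countBy-tabulate P (λ q → f (fsuc q))))

  count≡Σ₂ : ∀ {n} (P : Fin n × Fin n → Bool) → count P ≡ Σ₂ (λ p q → χ (P (p , q)))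
  count≡Σ₂ {n} P = go (λ p → p)
    where
    go : ∀ {m} (f : Fin m → Fin n) → countBy P (cartesianProduct (tabulate f) (allFin n)) ≡ sum (λ p → sum (λ q → χ (P (f p , q))))
    go {zero}  f = refl
    go {suc m} f = trans (countBy-++ P (map (f fzero ,_) (allFin n)) _)
                         (cong₂ _+_ (trans (cong (countBy P) (map-tabulate (λ q → q) (f fzero ,_))) (countBy-tabulate P (f fzero ,_)))
                                    (go (λ p → f (fsuc p))))

  countBy-filter-∷ : ∀ {A : Set} (P Q : A → Bool) x xs →
    countBy P (filterᵇ Q (x ∷ xs)) ≡ χ (Q x ∧ P x) + countBy P (filterᵇ Q xs)
  countBy-filter-∷ P Q x xs with Q x
  ... | true  = countBy-∷ P x _
  ... | false = refl

  countBy-filter : ∀ {A : Set} (P Q : A → Bool) xs → countBy P (filterᵇ Q xs) ≡ countBy (λ z → Q z ∧ P z) xs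
  countBy-filter P Q []       = refl
  countBy-filter P Q (x ∷ xs) = trans (countBy-filter-∷ P Q x xs)
    (trans (cong (χ (Q x ∧ P x) +_) (countBy-filter P Q xs)) (sym (countBy-∷ (λ z → Q z ∧ P z) x xs)))

  countBy-partition : ∀ {A : Set} (P Q : A → Bool) xs →
    countBy P (filterᵇ Q xs) + countBy P (filterᵇ (not ∘ Q) xs) ≡ countBy P xs
  countBy-partition P Q []       = refl
  countBy-partition P Q (x ∷ xs) with Q x
  ... | true  = trans (cong (_+ _) (countBy-∷ P x _)) (trans (+-assoc (χ (P x)) _ _)
                      (trans (cong (χ (P x) +_) (countBy-partition P Q xs)) (sym (countBy-∷ P x xs))))
  ... | false = trans (cong (_ +_) (countBy-∷ P x _)) (trans (x∙yz≈y∙xz (countBy P (filterᵇ Q xs)) (χ (P x)) (countBy P (filterᵇ (not ∘ Q) xs)))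
                      (trans (cong (χ (P x) +_) (countBy-partition P Q xs)) (sym (countBy-∷ P x xs))))

  countBy-↭ : ∀ {A : Set} (P : A → Bool) {xs ys : List A} → xs ↭ ys → countBy P xs ≡ countBy P ys
  countBy-↭ P xs↭ys = ↭-length (filter-↭ _ xs↭ys)

  pairs-unique : ∀ n → Unique (pairs n)
  pairs-unique n = Unique.cartesianProduct⁺ (Unique.allFin⁺ n) (Unique.allFin⁺ n)

  ∈-pairs : ∀ {n} (z : BRefl n) → z ∈ pairs n
  ∈-pairs (k , l) = ∈-cartesianProduct⁺ (∈-allFin k) (∈-allFin l)

  countBy-unique : ∀ {n} {Δ : List (BRefl n)} (D P : BRefl n → Bool) → Unique Δ → (∀ z → z ∈ Δ ⇔ T (D z)) →
    countBy P Δ ≡ Σ₂ (λ p q → χ (D (p , q) ∧ P (p , q)))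
  countBy-unique {n} {Δ} D P uniq members = begin
    countBy P Δ                         ≡⟨ countBy-↭ P (∼bag⇒↭ (unique∧set⇒bag uniq (Unique.filter⁺ _ (pairs-unique n)) same)) ⟩
    countBy P (filterᵇ D (pairs n))     ≡⟨ countBy-filter P D (pairs n) ⟩
    count (λ z → D z ∧ P z)             ≡⟨ count≡Σ₂ (λ z → D z ∧ P z) ⟩
    Σ₂ (λ p q → χ (D (p , q) ∧ P (p , q))) ∎
    where
    open ≡-Reasoning
    same : ∀ {z} → z ∈ Δ ⇔ z ∈ filterᵇ D (pairs n)
    same {z} = mk⇔ (λ z∈Δ → ∈-filter⁺ _ (∈-pairs z) (Equivalence.to (members z) z∈Δ))
                   (λ z∈D → Equivalence.from (members z) (proj₂ (∈-filter⁻ _ {xs = pairs n} z∈D)))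

  -- The length identity for a descent (i, j̄)

  χ-mono : ∀ {A B : Bool} → (T A → T B) → χ A ≤ χ B
  χ-mono {false}         _   = z≤n
  χ-mono {true}  {true}  _   = ≤-refl
  χ-mono {true}  {false} A⇒B = ⊥-elim (A⇒B _)

  χ-∧-≤ : ∀ l b P → χ ((l ∧ b) ∧ P) ≤ χ (l ∧ P)
  χ-∧-≤ false _     _ = z≤n
  χ-∧-≤ true  false _ = z≤n
  χ-∧-≤ true  true  _ = ≤-refl

  -- The data of a pair (p, q) of positions that enter ℓ: p < q, p ≤ q, and whether (p, q̄) is a pair of Φ
  -- strictly after the reflection δ under consideration.
  record PairPos : Set where
    constructor ⟨_,_,_⟩
    field
      lt le after : Bool
  open PairPos

  PairTerm : ℕ → Set
  PairTerm n = PairPos → (x y x' y' : Val n) → ℕ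

  lengthTerm : ∀ {n} → PairPos → Val n → Val n → ℕ
  lengthTerm d x y = χ (lt d ∧ (x >ᵛ y)) + χ (le d ∧ (x >ᵛ bar y))

  segmentTerm : ∀ {n} → PairTerm n
  segmentTerm d x y _ _ = χ (after d ∧ (x >ᵛ bar y))

  weighted : ∀ {n} → PairTerm n
  weighted d x y x' y' = lengthTerm d x y + 2 * segmentTerm d x' y' x' y'

  -- Laid out exactly as block and cross unfold on i ∷ j ∷ [] and on i ∷ [], so that the matching
  -- lemmas (block₂-at, …) hold by refl.
  block₂ᵛ : ∀ {n} → PairTerm n → (dᵢᵢ dᵢⱼ dⱼᵢ dⱼⱼ : PairPos) (a b a' b' : Val n) → ℕ
  block₂ᵛ f dᵢᵢ dᵢⱼ dⱼᵢ dⱼⱼ a b a' b' =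
    f dᵢᵢ a a a' a' + (f dᵢⱼ a b a' b' + 0) + (f dⱼᵢ b a b' a' + (f dⱼⱼ b b b' b' + 0) + 0)

  cross₂ᵛ : ∀ {n} → PairTerm n → (dᵢ dᵢ' dⱼ dⱼ' : PairPos) (a b x a' b' x' : Val n) → ℕ
  cross₂ᵛ f dᵢ dᵢ' dⱼ dⱼ' a b x a' b' x' =
    f dᵢ a x a' x' + f dᵢ' x a x' a' + (f dⱼ b x b' x' + f dⱼ' x b x' b' + 0)

  block₁ᵛ : ∀ {n} → PairTerm n → PairPos → (a a' : Val n) → ℕ
  block₁ᵛ f d a a' = f d a a a' a' + 0 + 0

  cross₁ᵛ : ∀ {n} → PairTerm n → (dᵢ dᵢ' : PairPos) (a x a' x' : Val n) → ℕ
  cross₁ᵛ f dᵢ dᵢ' a x a' x' = f dᵢ a x a' x' + f dᵢ' x a x' a' + 0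

  ⟨<⟩ ⟨>⟩ ⟨=⟩ ⟨<after⟩ ⟨=after⟩ : PairPos
  ⟨<⟩      = ⟨ true  , true  , false ⟩
  ⟨>⟩      = ⟨ false , false , false ⟩
  ⟨=⟩      = ⟨ false , true  , false ⟩
  ⟨<after⟩ = ⟨ true  , true  , true  ⟩
  ⟨=after⟩ = ⟨ false , true  , true  ⟩

  -- a = w(i), b = w(j), x = w(q); reflecting by (i, j̄) turns them into b̄, ā and x.
  module _ {n} (a b : Val n) (a>b̄ : T (a >ᵛ bar b)) where

    private
      a≢b̄ : key a ≢ key (bar b)
      a≢b̄ eq = <-irrefl (sym eq) (<ᵇ⇒< (key (bar b)) (key a) a>b̄)

    reflect-block₂ : block₂ᵛ weighted ⟨=⟩ ⟨<⟩ ⟨>⟩ ⟨=after⟩ a b (bar b) (bar a)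
                   ≡ suc (block₂ᵛ weighted ⟨=⟩ ⟨<⟩ ⟨>⟩ ⟨=after⟩ (bar b) (bar a) a b)
    reflect-block₂ rewrite bar-involutive a | bar-involutive b | >ᵛ-flip a (bar a) (key-bar-≢ a) | >ᵛ-flip b (bar b) (key-bar-≢ b)
      | bar-antitone b a | >ᵛ-flip a (bar b) a≢b̄ | Equivalence.to T-≡ a>b̄
      with a >ᵛ bar a | a >ᵛ b | b >ᵛ bar b
    ... | true  | true  | true  = refl
    ... | true  | true  | false = refl
    ... | true  | false | true  = refl
    ... | true  | false | false = refl
    ... | false | true  | true  = refl
    ... | false | true  | false = refl
    ... | false | false | true  = refl
    ... | false | false | false = refl

    segment-block₂ : block₂ᵛ segmentTerm ⟨=⟩ ⟨<⟩ ⟨>⟩ ⟨=after⟩ (bar b) (bar a) (bar b) (bar a)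
                   ≤ block₂ᵛ segmentTerm ⟨=⟩ ⟨<⟩ ⟨>⟩ ⟨=after⟩ a b a b
    segment-block₂ rewrite bar-involutive a =
      +-monoˡ-≤ 0 (+-monoˡ-≤ 0 (χ-mono (λ h → >ᵛ-trans {u = b} {bar a} {bar b} (subst T (>ᵛ-bar-comm a b) a>b̄) (>ᵛ-trans {u = bar a} {a} {bar b} h a>b̄))))

    module _ (x : Val n) (x≢a : key x ≢ key a) (x≢b : key x ≢ key b) (x≢ā : key x ≢ key (bar a)) (x≢b̄ : key x ≢ key (bar b)) where

      reflect-cross-below : cross₂ᵛ weighted ⟨>⟩ ⟨<⟩ ⟨>⟩ ⟨<⟩ a b x (bar b) (bar a) x
                          ≡ cross₂ᵛ weighted ⟨>⟩ ⟨<⟩ ⟨>⟩ ⟨<⟩ (bar b) (bar a) x a b x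
      reflect-cross-below rewrite bar-involutive a | bar-involutive b
        with x >ᵛ a | x >ᵛ b | x >ᵛ bar a | x >ᵛ bar b
      ... | true  | true  | true  | true  = refl
      ... | true  | true  | true  | false = refl
      ... | true  | true  | false | true  = refl
      ... | true  | true  | false | false = refl
      ... | true  | false | true  | true  = refl
      ... | true  | false | true  | false = refl
      ... | true  | false | false | true  = refl
      ... | true  | false | false | false = refl
      ... | false | true  | true  | true  = refl
      ... | false | true  | true  | false = refl
      ... | false | true  | false | true  = refl
      ... | false | true  | false | false = refl
      ... | false | false | true  | true  = refl
      ... | false | false | true  | false = refl
      ... | false | false | false | true  = refl
      ... | false | false | false | false = refl

      reflect-cross-between : cross₂ᵛ weighted ⟨<⟩ ⟨>⟩ ⟨>⟩ ⟨<after⟩ a b x (bar b) (bar a) x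
                            ≡ cross₂ᵛ weighted ⟨<⟩ ⟨>⟩ ⟨>⟩ ⟨<after⟩ (bar b) (bar a) x a b x
      reflect-cross-between rewrite bar-involutive a | >ᵛ-flip x a x≢a | >ᵛ-bar-comm a x
        | >ᵛ-flip x (bar b) x≢b̄ | bar-antitone b x
        with x >ᵛ a | x >ᵛ b | x >ᵛ bar a | x >ᵛ bar b
      ... | true  | true  | true  | true  = refl
      ... | true  | true  | true  | false = refl
      ... | true  | true  | false | true  = refl
      ... | true  | true  | false | false = refl
      ... | true  | false | true  | true  = refl
      ... | true  | false | true  | false = refl
      ... | true  | false | false | true  = refl
      ... | true  | false | false | false = refl
      ... | false | true  | true  | true  = refl
      ... | false | true  | true  | false = refl
      ... | false | true  | false | true  = refl
      ... | false | true  | false | false = refl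
      ... | false | false | true  | true  = refl
      ... | false | false | true  | false = refl
      ... | false | false | false | true  = refl
      ... | false | false | false | false = refl

      reflect-cross-above : cross₂ᵛ weighted ⟨<after⟩ ⟨>⟩ ⟨<after⟩ ⟨>⟩ a b x (bar b) (bar a) x
                          ≡ cross₂ᵛ weighted ⟨<after⟩ ⟨>⟩ ⟨<after⟩ ⟨>⟩ (bar b) (bar a) x a b x
      reflect-cross-above rewrite >ᵛ-flip x a x≢a | >ᵛ-bar-comm a x | >ᵛ-flip x (bar b) x≢b̄ | bar-antitone b x
        | >ᵛ-flip x b x≢b | >ᵛ-bar-comm b x | >ᵛ-flip x (bar a) x≢ā | bar-antitone a x
        with x >ᵛ a | x >ᵛ b | x >ᵛ bar a | x >ᵛ bar b
      ... | true  | true  | true  | true  = refl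
      ... | true  | true  | true  | false = refl
      ... | true  | true  | false | true  = refl
      ... | true  | true  | false | false = refl
      ... | true  | false | true  | true  = refl
      ... | true  | false | true  | false = refl
      ... | true  | false | false | true  = refl
      ... | true  | false | false | false = refl
      ... | false | true  | true  | true  = refl
      ... | false | true  | true  | false = refl
      ... | false | true  | false | true  = refl
      ... | false | true  | false | false = refl
      ... | false | false | true  | true  = refl
      ... | false | false | true  | false = refl
      ... | false | false | false | true  = refl
      ... | false | false | false | false = refl

      segment-cross-between : cross₂ᵛ segmentTerm ⟨<⟩ ⟨>⟩ ⟨>⟩ ⟨<after⟩ (bar b) (bar a) x (bar b) (bar a) x
                            ≤ cross₂ᵛ segmentTerm ⟨<⟩ ⟨>⟩ ⟨>⟩ ⟨<after⟩ a b x a b x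
      segment-cross-between rewrite bar-involutive a = +-monoˡ-≤ 0 (χ-mono (λ h → >ᵛ-trans {u = x} {a} {bar b} h a>b̄))

      segment-cross-above : cross₂ᵛ segmentTerm ⟨<after⟩ ⟨>⟩ ⟨<after⟩ ⟨>⟩ (bar b) (bar a) x (bar b) (bar a) x
                          ≤ cross₂ᵛ segmentTerm ⟨<after⟩ ⟨>⟩ ⟨<after⟩ ⟨>⟩ a b x a b x
      segment-cross-above rewrite bar-antitone b x | bar-antitone a x | >ᵛ-bar-comm a x | >ᵛ-bar-comm b x =
        +-mono-≤ (+-monoˡ-≤ 0 (χ-mono {x >ᵛ b} {x >ᵛ bar a} (λ h → >ᵛ-trans {u = x} {b} {bar a} h (subst T (>ᵛ-bar-comm a b) a>b̄))))
                 (+-monoˡ-≤ 0 (+-monoˡ-≤ 0 (χ-mono {x >ᵛ a} {x >ᵛ bar b} (λ h → >ᵛ-trans {u = x} {a} {bar b} h a>b̄))))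

  module _ {n} (a : Val n) (a>ā : T (a >ᵛ bar a)) where

    reflect-block₁ : block₁ᵛ weighted ⟨=⟩ a (bar a) ≡ suc (block₁ᵛ weighted ⟨=⟩ (bar a) a)
    reflect-block₁ rewrite bar-involutive a | >ᵛ-flip a (bar a) (key-bar-≢ a) | Equivalence.to T-≡ a>ā = refl

    module _ (x : Val n) (x≢a : key x ≢ key a) (x≢ā : key x ≢ key (bar a)) where

      reflect-cross₁-below : cross₁ᵛ weighted ⟨>⟩ ⟨<⟩ a x (bar a) x ≡ cross₁ᵛ weighted ⟨>⟩ ⟨<⟩ (bar a) x a x
      reflect-cross₁-below rewrite bar-involutive a with x >ᵛ a | x >ᵛ bar a
      ... | true  | true  = refl
      ... | true  | false = refl
      ... | false | true  = refl
      ... | false | false = refl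

      reflect-cross₁-above : cross₁ᵛ weighted ⟨<after⟩ ⟨>⟩ a x (bar a) x ≡ cross₁ᵛ weighted ⟨<after⟩ ⟨>⟩ (bar a) x a x
      reflect-cross₁-above rewrite >ᵛ-flip x a x≢a | >ᵛ-bar-comm a x | >ᵛ-flip x (bar a) x≢ā | bar-antitone a x
        with x >ᵛ a | x >ᵛ bar a
      ... | true  | true  = refl
      ... | true  | false = refl
      ... | false | true  = refl
      ... | false | false = refl

      segment-cross₁-above : cross₁ᵛ segmentTerm ⟨<after⟩ ⟨>⟩ (bar a) x (bar a) x ≤ cross₁ᵛ segmentTerm ⟨<after⟩ ⟨>⟩ a x a x
      segment-cross₁-above rewrite bar-antitone a x | >ᵛ-bar-comm a x =
        +-monoˡ-≤ 0 (+-monoˡ-≤ 0 (χ-mono {x >ᵛ a} {x >ᵛ bar a} (λ h → >ᵛ-trans {u = x} {a} {bar a} h a>ā)))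

  Σ₂-+ : ∀ {n} (f g : Fin n → Fin n → ℕ) → Σ₂ (λ p q → f p q + g p q) ≡ Σ₂ f + Σ₂ g
  Σ₂-+ f g = trans (sum-cong-≗ (λ p → ∑-distrib-+ (f p) (g p))) (∑-distrib-+ (λ p → sum (f p)) (λ p → sum (g p)))

  Σ₂-* : ∀ {n} k (f : Fin n → Fin n → ℕ) → Σ₂ (λ p q → k * f p q) ≡ k * Σ₂ f
  Σ₂-* k f = trans (sum-cong-≗ (λ p → sym (*-distribˡ-sum k (f p)))) (sym (*-distribˡ-sum k (λ p → sum (f p))))

  module Positions {n} (i j : Fin n) where

    pos : Fin n → Fin n → PairPos
    pos p q = ⟨ toℕ p <ᵇ toℕ q , toℕ p ≤ᵇ toℕ q , (toℕ p ≤ᵇ toℕ q) ∧ before p q (i , j) ⟩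

    pairwise : PairTerm n → Window n → Window n → Fin n → Fin n → ℕ
    pairwise f u v p q = f (pos p q) (lookup u p) (lookup u q) (lookup v p) (lookup v q)

    segmentCount : Window n → ℕ
    segmentCount u = Σ₂ (pairwise segmentTerm u u)

    len≡Σ₂ : ∀ u → len u ≡ Σ₂ (λ p q → lengthTerm (pos p q) (lookup u p) (lookup u q))
    len≡Σ₂ u = trans (cong₂ _+_ (count≡Σ₂ {n} _) (count≡Σ₂ {n} _))
      (sym (Σ₂-+ (λ p q → χ ((toℕ p <ᵇ toℕ q) ∧ (lookup u p >ᵛ lookup u q)))
                 (λ p q → χ ((toℕ p ≤ᵇ toℕ q) ∧ (lookup u p >ᵛ bar (lookup u q))))))

    Σ₂-weighted : ∀ u v → Σ₂ (pairwise weighted u v) ≡ len u + 2 * segmentCount v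
    Σ₂-weighted u v = trans (Σ₂-+ (λ p q → lengthTerm (pos p q) (lookup u p) (lookup u q)) (λ p q → 2 * pairwise segmentTerm v v p q)) (cong₂ _+_ (sym (len≡Σ₂ u)) (Σ₂-* 2 (pairwise segmentTerm v v)))

    segmentCount≤len : ∀ u → segmentCount u ≤ len u
    segmentCount≤len u = subst (segmentCount u ≤_) (sym (len≡Σ₂ u)) (sum-mono-≤ λ p → sum-mono-≤ λ q →
      ≤-trans (χ-∧-≤ (toℕ p ≤ᵇ toℕ q) (before p q (i , j)) (lookup u p >ᵛ bar (lookup u q))) (m≤n+m _ _))

    pos-< : ∀ {p q c} → toℕ p < toℕ q → before p q (i , j) ≡ c → pos p q ≡ ⟨ true , true , c ⟩
    pos-< p<q refl rewrite <ᵇ-true p<q | <ᵇ-true (m<n⇒m<1+n p<q) = refl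

    pos-> : ∀ {p q} → toℕ q < toℕ p → pos p q ≡ ⟨>⟩
    pos-> q<p rewrite <ᵇ-false (<⇒≯ q<p) | <ᵇ-false (λ p<1+q → <⇒≱ q<p (≤-pred p<1+q)) = refl

    pos-≡ : ∀ {p c} → before p p (i , j) ≡ c → pos p p ≡ ⟨ false , true , c ⟩
    pos-≡ {p} refl rewrite <ᵇ-false (<-irrefl {toℕ p} refl) | <ᵇ-true (n<1+n (toℕ p)) = refl

    before-later : ∀ p {q} → toℕ j < toℕ q → before p q (i , j) ≡ true
    before-later p j<q rewrite <ᵇ-true j<q = refl

    before-earlier : ∀ p {q} → toℕ q < toℕ j → before p q (i , j) ≡ false
    before-earlier p q<j rewrite <ᵇ-false (<⇒≯ q<j) | ≡ᵇ-false (>⇒≢ q<j) = refl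

    before-same-column : ∀ p → before p j (i , j) ≡ (toℕ i <ᵇ toℕ p)
    before-same-column p rewrite <ᵇ-false (<-irrefl {toℕ j} refl) | ≡ᵇ-refl (toℕ j) = refl

    module _ (f : PairTerm n) (u v : Window n) where

      block₂-at : ∀ {dᵢᵢ dᵢⱼ dⱼᵢ dⱼⱼ a₀ b₀ a₁ b₁} →
        pos i i ≡ dᵢᵢ → pos i j ≡ dᵢⱼ → pos j i ≡ dⱼᵢ → pos j j ≡ dⱼⱼ →
        lookup u i ≡ a₀ → lookup u j ≡ b₀ → lookup v i ≡ a₁ → lookup v j ≡ b₁ →
        block (i ∷ j ∷ []) (pairwise f u v) ≡ block₂ᵛ f dᵢᵢ dᵢⱼ dⱼᵢ dⱼⱼ a₀ b₀ a₁ b₁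
      block₂-at refl refl refl refl refl refl refl refl = refl

      cross₂-at : ∀ {q dᵢ dᵢ' dⱼ dⱼ' a₀ b₀ x₀ a₁ b₁ x₁} →
        pos i q ≡ dᵢ → pos q i ≡ dᵢ' → pos j q ≡ dⱼ → pos q j ≡ dⱼ' →
        lookup u i ≡ a₀ → lookup u j ≡ b₀ → lookup u q ≡ x₀ → lookup v i ≡ a₁ → lookup v j ≡ b₁ → lookup v q ≡ x₁ →
        cross (i ∷ j ∷ []) (pairwise f u v) q ≡ cross₂ᵛ f dᵢ dᵢ' dⱼ dⱼ' a₀ b₀ x₀ a₁ b₁ x₁
      cross₂-at refl refl refl refl refl refl refl refl refl refl = refl

      block₁-at : ∀ {d a₀ a₁} → pos i i ≡ d → lookup u i ≡ a₀ → lookup v i ≡ a₁ →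
        block (i ∷ []) (pairwise f u v) ≡ block₁ᵛ f d a₀ a₁
      block₁-at refl refl refl = refl

      cross₁-at : ∀ {q dᵢ dᵢ' a₀ x₀ a₁ x₁} → pos i q ≡ dᵢ → pos q i ≡ dᵢ' →
        lookup u i ≡ a₀ → lookup u q ≡ x₀ → lookup v i ≡ a₁ → lookup v q ≡ x₁ →
        cross (i ∷ []) (pairwise f u v) q ≡ cross₁ᵛ f dᵢ dᵢ' a₀ x₀ a₁ x₁
      cross₁-at refl refl refl refl refl refl = refl

  module Reflection {n} (w : Window n) (i j : Fin n) where

    w' : Window n
    w' = actBar w i j

    a b : Val n
    a = lookup w i
    b = lookup w j

    open Positions i j public

    length-from-weighted : Σ₂ (pairwise weighted w w') ≡ suc (Σ₂ (pairwise weighted w' w)) →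
      len w + 2 * segmentCount w' ≡ suc (len w' + 2 * segmentCount w)
    length-from-weighted eq = trans (sym (Σ₂-weighted w w')) (trans eq (cong suc (Σ₂-weighted w' w)))

    pairwise-outside : ∀ (f : PairTerm n) {p q} → p ≢ i → p ≢ j → q ≢ i → q ≢ j → pairwise f w w' p q ≡ pairwise f w' w p q
    pairwise-outside f p≢i p≢j q≢i q≢j
      rewrite lookup-actBar-other w i j p≢i p≢j | lookup-actBar-other w i j q≢i q≢j = refl

    key-distinct : IsSignedPerm w → ∀ {p q} → p ≢ q → key (lookup w p) ≢ key (lookup w q)
    key-distinct signed {p} {q} p≢q eq = p≢q (signed p q (cong idx (key-injective {u = lookup w p} {lookup w q} eq)))

    key-distinct-bar : IsSignedPerm w → ∀ {p q} → p ≢ q → key (lookup w p) ≢ key (bar (lookup w q))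
    key-distinct-bar signed {p} {q} p≢q eq = p≢q (signed p q (cong idx (key-injective {u = lookup w p} {bar (lookup w q)} eq)))

    lookup-w'-i : lookup w' i ≡ bar b
    lookup-w'-i = lookup-actBar-i w i j

    lookup-w'-j : lookup w' j ≡ bar a
    lookup-w'-j = lookup-actBar-j w i j

    module Distinct (signed : IsSignedPerm w) (i<j : toℕ i < toℕ j) (a>b̄ : T (a >ᵛ bar b)) where

      S : List (Fin n)
      S = i ∷ j ∷ []

      i≢j : i ≢ j
      i≢j i≡j = <-irrefl (cong toℕ i≡j) i<j

      S-unique : Unique S
      S-unique = (i≢j ∷ []) ∷ [] ∷ []

      block-positions : ∀ f u v {a₀ b₀ a₁ b₁} → lookup u i ≡ a₀ → lookup u j ≡ b₀ → lookup v i ≡ a₁ → lookup v j ≡ b₁ →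
        block S (pairwise f u v) ≡ block₂ᵛ f ⟨=⟩ ⟨<⟩ ⟨>⟩ ⟨=after⟩ a₀ b₀ a₁ b₁
      block-positions f u v = block₂-at f u v
        (pos-≡ (before-earlier i i<j))
        (pos-< i<j (trans (before-same-column i) (<ᵇ-false (n≮n (toℕ i)))))
        (pos-> i<j)
        (pos-≡ (trans (before-same-column j) (<ᵇ-true i<j)))

      module _ {q} (q≢i : q ≢ i) (q≢j : q ≢ j) {dᵢ dᵢ' dⱼ dⱼ'}
               (eᵢ : pos i q ≡ dᵢ) (eᵢ' : pos q i ≡ dᵢ') (eⱼ : pos j q ≡ dⱼ) (eⱼ' : pos q j ≡ dⱼ') where

        private
          x = lookup w q
          lookup-w'-q = lookup-actBar-other w i j q≢i q≢j

        cross-region :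
          cross₂ᵛ weighted dᵢ dᵢ' dⱼ dⱼ' a b x (bar b) (bar a) x ≡ cross₂ᵛ weighted dᵢ dᵢ' dⱼ dⱼ' (bar b) (bar a) x a b x →
          cross₂ᵛ segmentTerm dᵢ dᵢ' dⱼ dⱼ' (bar b) (bar a) x (bar b) (bar a) x ≤ cross₂ᵛ segmentTerm dᵢ dᵢ' dⱼ dⱼ' a b x a b x →
          (cross S (pairwise weighted w w') q ≡ cross S (pairwise weighted w' w) q) ×
          (cross S (pairwise segmentTerm w' w') q ≤ cross S (pairwise segmentTerm w w) q)
        cross-region weighted-table segment-table =
          trans (cross₂-at weighted w w' eᵢ eᵢ' eⱼ eⱼ' refl refl refl lookup-w'-i lookup-w'-j lookup-w'-q)
                (trans weighted-table (sym (cross₂-at weighted w' w eᵢ eᵢ' eⱼ eⱼ' lookup-w'-i lookup-w'-j lookup-w'-q refl refl refl))) ,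
          subst₂ _≤_ (sym (cross₂-at segmentTerm w' w' eᵢ eᵢ' eⱼ eⱼ' lookup-w'-i lookup-w'-j lookup-w'-q lookup-w'-i lookup-w'-j lookup-w'-q))
                     (sym (cross₂-at segmentTerm w w eᵢ eᵢ' eⱼ eⱼ' refl refl refl refl refl refl))
                     segment-table

      cross-outside : ∀ q → q ≢ i → q ≢ j →
        (cross S (pairwise weighted w w') q ≡ cross S (pairwise weighted w' w) q) ×
        (cross S (pairwise segmentTerm w' w') q ≤ cross S (pairwise segmentTerm w w) q)
      cross-outside q q≢i q≢j with <-cmp (toℕ q) (toℕ i) | <-cmp (toℕ q) (toℕ j)
      ... | tri≈ _ q≡i _ | _ = ⊥-elim (q≢i (Fin.toℕ-injective q≡i))
      ... | _ | tri≈ _ q≡j _ = ⊥-elim (q≢j (Fin.toℕ-injective q≡j))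
      ... | tri< q<i _ _ | tri< q<j _ _ =
        cross-region q≢i q≢j (pos-> q<i) (pos-< q<i (before-earlier q i<j)) (pos-> q<j)
          (pos-< q<j (trans (before-same-column q) (<ᵇ-false (<⇒≯ q<i))))
          (reflect-cross-below a b a>b̄ x x≢a x≢b x≢ā x≢b̄) z≤n
        where x = lookup w q ; x≢a = key-distinct signed q≢i ; x≢b = key-distinct signed q≢j
              x≢ā = key-distinct-bar signed q≢i ; x≢b̄ = key-distinct-bar signed q≢j
      ... | tri< q<i _ _ | tri> _ _ j<q = ⊥-elim (<-asym (<-trans q<i i<j) j<q)
      ... | tri> _ _ i<q | tri< q<j _ _ =
        cross-region q≢i q≢j (pos-< i<q (before-earlier i q<j)) (pos-> i<q) (pos-> q<j)
          (pos-< q<j (trans (before-same-column q) (<ᵇ-true i<q)))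
          (reflect-cross-between a b a>b̄ x x≢a x≢b x≢ā x≢b̄) (segment-cross-between a b a>b̄ x x≢a x≢b x≢ā x≢b̄)
        where x = lookup w q ; x≢a = key-distinct signed q≢i ; x≢b = key-distinct signed q≢j
              x≢ā = key-distinct-bar signed q≢i ; x≢b̄ = key-distinct-bar signed q≢j
      ... | tri> _ _ i<q | tri> _ _ j<q =
        cross-region q≢i q≢j (pos-< i<q (before-later i j<q)) (pos-> i<q) (pos-< j<q (before-later j j<q)) (pos-> j<q)
          (reflect-cross-above a b a>b̄ x x≢a x≢b x≢ā x≢b̄) (segment-cross-above a b a>b̄ x x≢a x≢b x≢ā x≢b̄)
        where x = lookup w q ; x≢a = key-distinct signed q≢i ; x≢b = key-distinct signed q≢j
              x≢ā = key-distinct-bar signed q≢i ; x≢b̄ = key-distinct-bar signed q≢j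

      weighted-identity : Σ₂ (pairwise weighted w w') ≡ suc (Σ₂ (pairwise weighted w' w))
      weighted-identity = Σ₂-≡-suc S-unique
        (trans (block-positions weighted w w' refl refl lookup-w'-i lookup-w'-j)
               (trans (reflect-block₂ a b a>b̄) (cong suc (sym (block-positions weighted w' w lookup-w'-i lookup-w'-j refl refl)))))
        (λ q q∉S → proj₁ (cross-outside q (q∉S ∘ here) (q∉S ∘ there ∘ here)))
        (λ p q p∉S q∉S → pairwise-outside weighted (p∉S ∘ here) (p∉S ∘ there ∘ here) (q∉S ∘ here) (q∉S ∘ there ∘ here))

      segment-decreases : segmentCount w' ≤ segmentCount w
      segment-decreases = Σ₂-mono S-unique
        (subst₂ _≤_ (sym (block-positions segmentTerm w' w' lookup-w'-i lookup-w'-j lookup-w'-i lookup-w'-j))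
                    (sym (block-positions segmentTerm w w refl refl refl refl)) (segment-block₂ a b a>b̄))
        (λ q q∉S → proj₂ (cross-outside q (q∉S ∘ here) (q∉S ∘ there ∘ here)))
        (λ p q p∉S q∉S → ≤-reflexive (sym (pairwise-outside segmentTerm (p∉S ∘ here) (p∉S ∘ there ∘ here) (q∉S ∘ here) (q∉S ∘ there ∘ here))))

  module Diagonal {n} (w : Window n) (i : Fin n) (signed : IsSignedPerm w) where
    open Reflection w i i

    S : List (Fin n)
    S = i ∷ []

    S-unique : Unique S
    S-unique = [] ∷ []

    pos-ii : pos i i ≡ ⟨=⟩
    pos-ii = pos-≡ (trans (before-same-column i) (<ᵇ-false (n≮n (toℕ i))))

    module _ (a>ā : T (a >ᵛ bar a)) where

      module _ {q} (q≢i : q ≢ i) {dᵢ dᵢ'} (eᵢ : pos i q ≡ dᵢ) (eᵢ' : pos q i ≡ dᵢ') where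

        private
          x = lookup w q
          lookup-w'-q = lookup-actBar-other w i i q≢i q≢i

        cross-region :
          cross₁ᵛ weighted dᵢ dᵢ' a x (bar a) x ≡ cross₁ᵛ weighted dᵢ dᵢ' (bar a) x a x →
          cross₁ᵛ segmentTerm dᵢ dᵢ' (bar a) x (bar a) x ≤ cross₁ᵛ segmentTerm dᵢ dᵢ' a x a x →
          (cross S (pairwise weighted w w') q ≡ cross S (pairwise weighted w' w) q) ×
          (cross S (pairwise segmentTerm w' w') q ≤ cross S (pairwise segmentTerm w w) q)
        cross-region weighted-table segment-table =
          trans (cross₁-at weighted w w' eᵢ eᵢ' refl refl lookup-w'-i lookup-w'-q)
                (trans weighted-table (sym (cross₁-at weighted w' w eᵢ eᵢ' lookup-w'-i lookup-w'-q refl refl))) ,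
          subst₂ _≤_ (sym (cross₁-at segmentTerm w' w' eᵢ eᵢ' lookup-w'-i lookup-w'-q lookup-w'-i lookup-w'-q))
                     (sym (cross₁-at segmentTerm w w eᵢ eᵢ' refl refl refl refl))
                     segment-table

      cross-outside : ∀ q → q ≢ i →
        (cross S (pairwise weighted w w') q ≡ cross S (pairwise weighted w' w) q) ×
        (cross S (pairwise segmentTerm w' w') q ≤ cross S (pairwise segmentTerm w w) q)
      cross-outside q q≢i with <-cmp (toℕ q) (toℕ i)
      ... | tri≈ _ q≡i _ = ⊥-elim (q≢i (Fin.toℕ-injective q≡i))
      ... | tri< q<i _ _ =
        cross-region q≢i (pos-> q<i) (pos-< q<i (trans (before-same-column q) (<ᵇ-false (<⇒≯ q<i))))
          (reflect-cross₁-below a a>ā x x≢a x≢ā) z≤n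
        where x = lookup w q ; x≢a = key-distinct signed q≢i ; x≢ā = key-distinct-bar signed q≢i
      ... | tri> _ _ i<q =
        cross-region q≢i (pos-< i<q (before-later i i<q)) (pos-> i<q)
          (reflect-cross₁-above a a>ā x x≢a x≢ā) (segment-cross₁-above a a>ā x x≢a x≢ā)
        where x = lookup w q ; x≢a = key-distinct signed q≢i ; x≢ā = key-distinct-bar signed q≢i

      weighted-identity : Σ₂ (pairwise weighted w w') ≡ suc (Σ₂ (pairwise weighted w' w))
      weighted-identity = Σ₂-≡-suc S-unique
        (trans (block₁-at weighted w w' pos-ii refl lookup-w'-i)
               (trans (reflect-block₁ a a>ā) (cong suc (sym (block₁-at weighted w' w pos-ii lookup-w'-i refl)))))
        (λ q q∉S → proj₁ (cross-outside q (q∉S ∘ here)))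
        (λ p q p∉S q∉S → pairwise-outside weighted (p∉S ∘ here) (p∉S ∘ here) (q∉S ∘ here) (q∉S ∘ here))

      segment-decreases : segmentCount w' ≤ segmentCount w
      segment-decreases = Σ₂-mono S-unique
        (subst₂ _≤_ (sym (block₁-at segmentTerm w' w' pos-ii lookup-w'-i lookup-w'-i))
                    (sym (block₁-at segmentTerm w w pos-ii refl refl)) z≤n)
        (λ q q∉S → proj₂ (cross-outside q (q∉S ∘ here)))
        (λ p q p∉S q∉S → ≤-reflexive (sym (pairwise-outside segmentTerm (p∉S ∘ here) (p∉S ∘ here) (q∉S ∘ here) (q∉S ∘ here))))

  length-reflection : ∀ {n} (w : Window n) (i j : Fin n) → IsSignedPerm w → toℕ i ≤ toℕ j →
    let open Reflection w i j in T (a >ᵛ bar b) →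
    (len w + 2 * segmentCount w' ≡ suc (len w' + 2 * segmentCount w)) × (segmentCount w' ≤ segmentCount w)
  length-reflection w i j signed i≤j a>b̄ with i Fin.≟ j
  ... | yes refl = length-from-weighted (weighted-identity a>b̄) , segment-decreases a>b̄
    where open Reflection w i i
          open Diagonal w i signed
  ... | no  i≢j  = length-from-weighted weighted-identity , segment-decreases
    where open Reflection w i j
          open Distinct signed (≤∧≢⇒< i≤j (i≢j ∘ Fin.toℕ-injective)) a>b̄

  -- Bruhat descents

  <B⇒len< : ∀ {n} {u v : Window n} → u <B v → len u < len v
  <B⇒len< (stepTr _ _ _ _ lt)  = lt
  <B⇒len< (stepBar _ _ _ _ lt) = lt
  <B⇒len< (trans<B u<v v<x)    = <-trans (<B⇒len< u<v) (<B⇒len< v<x)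

  length-drop : ∀ {n} (w : Window n) (i j : Fin n) → IsSignedPerm w → toℕ i ≤ toℕ j →
    let open Reflection w i j in T (a >ᵛ bar b) →
    Σ[ m ∈ ℕ ] (len w ≡ len w' + suc (2 * m)) × (m + segmentCount w' ≡ segmentCount w)
  length-drop w i j signed i≤j a>b̄ = let (eq , G'≤G) = length-reflection w i j signed i≤j a>b̄ in
    _ , cancel eq G'≤G , m∸n+n≡m G'≤G
    where
    open Reflection w i j
    cancel : ∀ {A B x y} → A + 2 * x ≡ suc (B + 2 * y) → x ≤ y → A ≡ B + suc (2 * (y ∸ x))
    cancel {A} {B} {x} {y} eq x≤y = +-cancelʳ-≡ (2 * x) A _ (trans eq (regroup B x (y ∸ x) (m∸n+n≡m x≤y)))
      where
      regroup : ∀ B x m {y} → m + x ≡ y → suc (B + 2 * y) ≡ B + suc (2 * m) + 2 * x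
      regroup B x m refl = ring B x m
        where ring : ∀ B x m → suc (B + 2 * (m + x)) ≡ B + suc (2 * m) + 2 * x
              ring = solve-∀

  actBar-below : ∀ {n} (w : Window n) (i j : Fin n) → IsSignedPerm w → toℕ i ≤ toℕ j →
    T (lookup w i >ᵛ bar (lookup w j)) → actBar w i j <B w
  actBar-below w i j signed i≤j a>b̄ = subst (w' <B_) (actBar-involutive w i j) (stepBar w' i j i≤j w'<w'')
    where
    w' = actBar w i j
    w'<w'' : len w' < len (actBar w' i j)
    w'<w'' rewrite actBar-involutive w i j | proj₁ (proj₂ (length-drop w i j signed i≤j a>b̄)) = m<m+n (len w') (s≤s z≤n)

  actBar-not-below : ∀ {n} (w : Window n) (i j : Fin n) → IsSignedPerm w → toℕ i ≤ toℕ j →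
    ¬ T (lookup w i >ᵛ bar (lookup w j)) → ¬ (actBar w i j <B w)
  actBar-not-below w i j signed i≤j a≯b̄ w'<w = <-asym (<B⇒len< w'<w) w<w'
    where
    w' = actBar w i j
    a = lookup w i
    b = lookup w j
    a≢b̄ : key a ≢ key (bar b)
    a≢b̄ with i Fin.≟ j
    ... | yes refl = key-bar-≢ a
    ... | no  i≢j  = Reflection.key-distinct-bar w i j signed i≢j
    w'ᵢ>w'ⱼ : T (lookup w' i >ᵛ bar (lookup w' j))
    w'ᵢ>w'ⱼ rewrite lookup-actBar-i w i j | lookup-actBar-j w i j | bar-involutive a | >ᵛ-flip a (bar b) a≢b̄ =
      ¬T⇒T-not a≯b̄
    w<w' : len w < len w'
    w<w' with length-drop w' i j (actBar-signed w i j signed) i≤j w'ᵢ>w'ⱼ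
    ... | _ , len-w' , _ rewrite actBar-involutive w i j = subst (len w <_) (sym len-w') (m<m+n (len w) (s≤s z≤n))

  -- The order of Φ and its final segments

  _≺_ : ∀ {n} → BRefl n → BRefl n → Set
  p ≺ (i , j) = T (before i j p)

  Lex : ∀ {n} → BRefl n → BRefl n → Set
  Lex (k , l) (i , j) = toℕ l < toℕ j ⊎ (toℕ l ≡ toℕ j × toℕ k < toℕ i)

  ≺⇒Lex : ∀ {n} {p q : BRefl n} → p ≺ q → Lex p q
  ≺⇒Lex {p = k , l} {i , j} p≺q with Equivalence.to T-∨ p≺q
  ... | inj₁ l<j = inj₁ (<ᵇ⇒< (toℕ l) (toℕ j) l<j)
  ... | inj₂ l=j∧k<i = let (l=j , k<i) = Equivalence.to T-∧ l=j∧k<i in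
    inj₂ (≡ᵇ⇒≡ (toℕ l) (toℕ j) l=j , <ᵇ⇒< (toℕ k) (toℕ i) k<i)

  Lex⇒≺ : ∀ {n} {p q : BRefl n} → Lex p q → p ≺ q
  Lex⇒≺ (inj₁ l<j)         = Equivalence.from T-∨ (inj₁ (<⇒<ᵇ l<j))
  Lex⇒≺ {p = k , l} {i , j} (inj₂ (l≡j , k<i)) =
    Equivalence.from T-∨ (inj₂ (Equivalence.from T-∧ (≡⇒≡ᵇ (toℕ l) (toℕ j) l≡j , <⇒<ᵇ k<i)))

  ≺-irrefl : ∀ {n} {p : BRefl n} → ¬ p ≺ p
  ≺-irrefl {p = p} p≺p with ≺⇒Lex {p = p} {p} p≺p
  ... | inj₁ l<l       = <-irrefl refl l<l
  ... | inj₂ (_ , k<k) = <-irrefl refl k<k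

  ≺-trans : ∀ {n} {p q r : BRefl n} → p ≺ q → q ≺ r → p ≺ r
  ≺-trans {p = p} {q} {r} p≺q q≺r = Lex⇒≺ {p = p} {r} (lex (≺⇒Lex {p = p} {q} p≺q) (≺⇒Lex {p = q} {r} q≺r))
    where
    lex : Lex p q → Lex q r → Lex p r
    lex (inj₁ x)       (inj₁ y)        = inj₁ (<-trans x y)
    lex (inj₁ x)       (inj₂ (e , _))  = inj₁ (subst (_ <_) e x)
    lex (inj₂ (e , _)) (inj₁ y)        = inj₁ (subst (_< _) (sym e) y)
    lex (inj₂ (e , x)) (inj₂ (e' , y)) = inj₂ (trans e e' , <-trans x y)

  inΦ : ∀ {n} → BRefl n → Bool
  inΦ (k , l) = toℕ k ≤ᵇ toℕ l

  column : ∀ n → Fin n → List (BRefl n)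
  column n l = map (λ k → (k , l)) (filterᵇ (λ k → toℕ k ≤ᵇ toℕ l) (allFin n))

  ∈-column : ∀ {n} {l : Fin n} {z} → z ∈ column n l → ∃ λ k → z ≡ (k , l) × T (toℕ k ≤ᵇ toℕ l)
  ∈-column {n} {l} z∈ with ∈-map⁻ (λ k → (k , l)) z∈
  ... | k , k∈ , refl = k , refl , proj₂ (∈-filter⁻ _ {xs = allFin n} k∈)

  ∈Φ⇔inΦ : ∀ {n} (z : BRefl n) → z ∈ Φ n ⇔ T (inΦ z)
  ∈Φ⇔inΦ {n} (k , l) = mk⇔ to from
    where
    to : (k , l) ∈ Φ n → T (inΦ (k , l))
    to z∈Φ with ∈-concat⁻′ (map (column n) (allFin n)) z∈Φ
    ... | _ , z∈c , c∈ with ∈-map⁻ (column n) c∈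
    ...   | l' , _ , refl with ∈-column {l = l'} z∈c
    ...     | _ , refl , k≤l = k≤l
    from : T (inΦ (k , l)) → (k , l) ∈ Φ n
    from k≤l = ∈-concat⁺′ (∈-map⁺ (λ k → (k , l)) (∈-filter⁺ _ (∈-allFin k) k≤l)) (∈-map⁺ (column n) (∈-allFin l))

  Φ-sorted : ∀ n → AllPairs _≺_ (Φ n)
  Φ-sorted n = AllPairs.concat⁺ (All.tabulate within) (AllPairs.map⁺ (AllPairs.tabulate⁺-< across))
    where
    within : ∀ {c} → c ∈ map (column n) (allFin n) → AllPairs _≺_ c
    within c∈ with ∈-map⁻ (column n) c∈
    ... | l , _ , refl = AllPairs.map⁺ (AllPairs.filter⁺ _ (AllPairs.tabulate⁺-<
            (λ {k} {k'} k<k' → Lex⇒≺ {p = k , l} {k' , l} (inj₂ (refl , k<k')))))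
    across : ∀ {l l' : Fin n} → toℕ l < toℕ l' → All (λ x → All (x ≺_) (column n l')) (column n l)
    across {l} {l'} l<l' = All.tabulate λ x∈ → All.tabulate λ y∈ → go x∈ y∈
      where
      go : ∀ {x y} → x ∈ column n l → y ∈ column n l' → x ≺ y
      go x∈ y∈ with ∈-column x∈ | ∈-column y∈
      ... | k , refl , _ | k' , refl , _ = Lex⇒≺ {p = k , l} {k' , l'} (inj₁ l<l')

  record IsFinalSegment {n} (Δ : List (BRefl n)) : Set where
    field
      sorted : AllPairs _≺_ Δ
      inside : All (T ∘ inΦ) Δ
      upward : ∀ {p q} → p ∈ Δ → p ≺ q → T (inΦ q) → q ∈ Δ

    unique : Unique Δ
    unique = AllPairs.map (λ {p} p≺q p≡q → ≺-irrefl {p = p} (subst (p ≺_) (sym p≡q) p≺q)) sorted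

  Φ-final : ∀ n → IsFinalSegment (Φ n)
  Φ-final n = record
    { sorted = Φ-sorted n
    ; inside = All.tabulate (λ {z} → Equivalence.to (∈Φ⇔inΦ z))
    ; upward = λ {_} {q} _ _ → Equivalence.from (∈Φ⇔inΦ q)
    }

  Φseg-final : ∀ n (i j : Fin n) → IsFinalSegment (Φseg n i j)
  Φseg-final n i j = record
    { sorted = AllPairs.filter⁺ _ (Φ-sorted n)
    ; inside = All.tabulate (λ {z} z∈ → Equivalence.to (∈Φ⇔inΦ z) (proj₁ (∈-filter⁻ _ {xs = Φ n} z∈)))
    ; upward = λ {p} {q} p∈ p≺q q∈Φ → ∈-filter⁺ _ (Equivalence.from (∈Φ⇔inΦ q) q∈Φ)
        (¬T⇒T-not (λ q≺ij → T-not⇒¬T (proj₂ (∈-filter⁻ _ {xs = Φ n} p∈)) (≺-trans {p = p} {q} {i , j} p≺q q≺ij)))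
    }

  module _ {n} {δ : BRefl n} {Δ : List (BRefl n)} (final : IsFinalSegment (δ ∷ Δ)) where
    open IsFinalSegment final

    private
      δ≺Δ : All (δ ≺_) Δ
      δ≺Δ = AllPairs.head sorted

    ∉-tail : δ ∉ Δ
    ∉-tail δ∈Δ = ≺-irrefl {p = δ} (All.lookup δ≺Δ δ∈Δ)

    ∈-tail⇔ : ∀ z → z ∈ Δ ⇔ T (inΦ z ∧ before (proj₁ z) (proj₂ z) δ)
    ∈-tail⇔ z = mk⇔
      (λ z∈Δ → Equivalence.from T-∧ (All.lookup inside (there z∈Δ) , All.lookup δ≺Δ z∈Δ))
      (λ z∈ → let (inΦ-z , δ≺z) = Equivalence.to T-∧ z∈ in
        tail-member (upward (here refl) δ≺z inΦ-z) δ≺z)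
      where
      tail-member : z ∈ δ ∷ Δ → δ ≺ z → z ∈ Δ
      tail-member (here refl) δ≺δ = ⊥-elim (≺-irrefl {p = δ} δ≺δ)
      tail-member (there z∈Δ) _   = z∈Δ

    tail-final : IsFinalSegment Δ
    tail-final = record
      { sorted = AllPairs.tail sorted
      ; inside = All.tail inside
      ; upward = λ {p} {q} p∈Δ p≺q inΦ-q → tail-member (upward (there p∈Δ) p≺q inΦ-q) p∈Δ p≺q
      }
      where
      tail-member : ∀ {p q} → q ∈ δ ∷ Δ → p ∈ Δ → p ≺ q → q ∈ Δ
      tail-member {p} (here refl) p∈Δ p≺δ = ⊥-elim (≺-irrefl {p = δ} (≺-trans {p = δ} {p} {δ} (All.lookup δ≺Δ p∈Δ) p≺δ))
      tail-member     (there q∈Δ) _   _   = q∈Δ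

  negInv : ∀ {n} → Window n → BRefl n → Bool
  negInv u (k , l) = lookup u k >ᵛ bar (lookup u l)

  countBy-tail : ∀ {n} {i j : Fin n} {Δ} → IsFinalSegment ((i , j) ∷ Δ) → ∀ u →
    countBy (negInv u) Δ ≡ Positions.segmentCount i j u
  countBy-tail final u = countBy-unique _ (negInv u) (IsFinalSegment.unique (tail-final final)) (∈-tail⇔ final)

  ℓ₋≡countBy-Φ : ∀ {n} (w : Window n) → ℓ₋ w ≡ countBy (negInv w) (Φ n)
  ℓ₋≡countBy-Φ {n} w = trans (count≡Σ₂ {n} _) (sym (countBy-unique inΦ (negInv w) (IsFinalSegment.unique (Φ-final n)) ∈Φ⇔inΦ))

  ℓ₋ij+countBy-Φseg : ∀ {n} (i j : Fin n) (w : Window n) → ℓ₋ij i j w + countBy (negInv w) (Φseg n i j) ≡ ℓ₋ w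
  ℓ₋ij+countBy-Φseg {n} i j w = trans (countBy-partition (negInv w) (before i j) (Φ n)) (sym (ℓ₋≡countBy-Φ w))

  -- Chains

  ⊆[]⇒≡[] : ∀ {A : Set} {T : List A} → T ⊆ [] → T ≡ []
  ⊆[]⇒≡[] [] = refl

  unique-singleton : ∀ {A : Set} {x : A} {L : List A} → Unique L → (∀ y → y ∈ L ⇔ y ≡ x) → L ≡ x ∷ []
  unique-singleton {x = x} {[]} _ members with () ← Equivalence.from (members x) refl
  unique-singleton {x = x} {y ∷ []} _ members = cong (_∷ []) (Equivalence.to (members y) (here refl))
  unique-singleton {x = x} {y ∷ z ∷ L} ((y≢z ∷ _) ∷ _) members =
    ⊥-elim (y≢z (trans (Equivalence.to (members y) (here refl)) (sym (Equivalence.to (members z) (there (here refl))))))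

  module Heads {A : Set} (_≟_ : DecidableEquality A) (δ : A) where

    startsWith : List A → Bool
    startsWith []      = false
    startsWith (x ∷ _) = does (x ≟ δ)

    others : List (List A) → List (List A)
    others = filterᵇ (not ∘ startsWith)

    tails : List (List A) → List (List A)
    tails []            = []
    tails ([] ∷ L)      = tails L
    tails ((x ∷ T) ∷ L) = if does (x ≟ δ) then T ∷ tails L else tails L

    tails⊆ : ∀ L {T} → T ∈ tails L → (δ ∷ T) ∈ L
    tails⊆ ([] ∷ L)      T∈ = there (tails⊆ L T∈)
    tails⊆ ((x ∷ T) ∷ L) T∈ with x ≟ δ | T∈
    ... | yes refl | here refl = here refl
    ... | yes refl | there T∈' = there (tails⊆ L T∈')
    ... | no  _    | T∈'       = there (tails⊆ L T∈')

    ⊆tails : ∀ L {T} → (δ ∷ T) ∈ L → T ∈ tails L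
    ⊆tails ([] ∷ L)      (there δT∈) = ⊆tails L δT∈
    ⊆tails ((x ∷ T) ∷ L) δT∈ with x ≟ δ | δT∈
    ... | yes refl | here refl  = here refl
    ... | yes refl | there δT∈' = there (⊆tails L δT∈')
    ... | no  x≢δ  | here refl  = ⊥-elim (x≢δ refl)
    ... | no  _    | there δT∈' = ⊆tails L δT∈'

    tails-unique : ∀ L → Unique L → Unique (tails L)
    tails-unique []            _           = []
    tails-unique ([] ∷ L)      (_ ∷ uniq)  = tails-unique L uniq
    tails-unique ((x ∷ T) ∷ L) (T∉ ∷ uniq) with x ≟ δ
    ... | yes refl = All.tabulate (λ T'∈ T≡T' → All.lookup T∉ (tails⊆ L T'∈) (cong (δ ∷_) T≡T')) ∷ tails-unique L uniq
    ... | no  _    = tails-unique L uniq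

    not-startsWith : ∀ {x} U → x ≢ δ → T (not (startsWith (x ∷ U)))
    not-startsWith {x} U x≢δ with x ≟ δ
    ... | yes x≡δ = x≢δ x≡δ
    ... | no  _   = _

    ¬startsWith-δ : ¬ T (not (does (δ ≟ δ)))
    ¬startsWith-δ with δ ≟ δ
    ... | yes _   = λ ()
    ... | no  δ≢δ = λ _ → δ≢δ refl

  chain-length : ∀ {n} (w : Window n) T → Chain w T → length T + len (actList w T) ≤ len w
  chain-length w []      _          = ≤-refl
  chain-length w (s ∷ T) (ws<w , ch) = ≤-trans (s≤s (chain-length (actB w s) T ch)) (<B⇒len< ws<w)

  [x+x]/2≡x : ∀ x → (x + x) / 2 ≡ x
  [x+x]/2≡x x = trans (cong (_/ 2) (x+x≡x*2 x)) (m*n/n≡m x 2)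
    where x+x≡x*2 : ∀ x → x + x ≡ x * 2
          x+x≡x*2 = solve-∀

  [2m+z]/2≡m+z/2 : ∀ m z → (2 * m + z) / 2 ≡ m + z / 2
  [2m+z]/2≡m+z/2 m z = trans (+-distrib-/-∣ˡ z (divides m (*-comm 2 m)))
                             (cong (_+ z / 2) (trans (cong (_/ 2) (*-comm 2 m)) (m*n/n≡m m 2)))

  -- ℓ(w) = ℓ(w') + 2m + 1 makes the exponent ½(ℓ(w) + ℓ(wT) − |T|) drop by exactly m when δ is peeled off T.
  exponent-step : ∀ {ℓw ℓw' ℓT k} m → k ≤ ℓw' → ℓw ≡ ℓw' + suc (2 * m) →
    ((ℓw + ℓT) ∸ suc k) / 2 ≡ m + ((ℓw' + ℓT) ∸ k) / 2
  exponent-step {ℓw' = ℓw'} {ℓT} {k} m k≤ℓw' refl = begin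
    ((ℓw' + suc (2 * m) + ℓT) ∸ suc k) / 2 ≡⟨ cong (λ z → (z ∸ suc k) / 2) (regroup ℓw' ℓT m) ⟩
    ((2 * m + (ℓw' + ℓT)) ∸ k) / 2        ≡⟨ cong (_/ 2) (+-∸-assoc (2 * m) (≤-trans k≤ℓw' (m≤m+n ℓw' ℓT))) ⟩
    (2 * m + ((ℓw' + ℓT) ∸ k)) / 2        ≡⟨ [2m+z]/2≡m+z/2 m _ ⟩
    m + ((ℓw' + ℓT) ∸ k) / 2              ∎
    where
    open ≡-Reasoning
    regroup : ∀ a b m → a + suc (2 * m) + b ≡ suc (2 * m + (a + b))
    regroup = solve-∀

  _≟ᴮ_ : ∀ {n} → DecidableEquality (BRefl n)
  _≟ᴮ_ = ≡-dec Fin._≟_ Fin._≟_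

  module Split {n} {δ : BRefl n} {Δ : List (BRefl n)} (final : IsFinalSegment (δ ∷ Δ))
               (w : Window n) (L : List (List (BRefl n))) (members : ∀ T → T ∈ L ⇔ InA (δ ∷ Δ) w T) where
    open Heads _≟ᴮ_ δ public

    private
      ∉Δ : ∀ {T} → T ⊆ Δ → ∀ {x U} → T ≡ x ∷ U → x ≢ δ
      ∉Δ T⊆Δ refl refl = ∉-tail final (Sublist.lookup T⊆Δ (here refl))

    others-members : ∀ T → T ∈ others L ⇔ InA Δ w T
    others-members U = mk⇔ to from
      where
      to : U ∈ others L → InA Δ w U
      to U∈ with ∈-filter⁻ _ {xs = L} U∈
      ... | U∈L , ¬δ∷ with Equivalence.to (members U) U∈L
      ...   | (_ ∷ʳ U⊆Δ) , chain  = U⊆Δ , chain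
      ...   | (refl ∷ _) , _      = ⊥-elim (¬startsWith-δ ¬δ∷)
      from : InA Δ w U → U ∈ others L
      from (U⊆Δ , chain) = ∈-filter⁺ _ (Equivalence.from (members U) (δ ∷ʳ U⊆Δ , chain)) (not-head U U⊆Δ)
        where
        not-head : ∀ V → V ⊆ Δ → T (not (startsWith V))
        not-head []      _    = _
        not-head (x ∷ U) x∷U⊆ = not-startsWith U (∉Δ x∷U⊆ refl)

    tails-members : actB w δ <B w → ∀ T → T ∈ tails L ⇔ InA Δ (actB w δ) T
    tails-members wδ<w T = mk⇔ to from
      where
      to : T ∈ tails L → InA Δ (actB w δ) T
      to T∈ with Equivalence.to (members (δ ∷ T)) (tails⊆ L T∈)
      ... | (refl ∷ T⊆Δ) , (_ , chain) = T⊆Δ , chain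
      ... | (_ ∷ʳ δ∷T⊆Δ) , _           = ⊥-elim (∉Δ δ∷T⊆Δ refl refl)
      from : InA Δ (actB w δ) T → T ∈ tails L
      from (T⊆Δ , chain) = ⊆tails L (Equivalence.from (members (δ ∷ T)) (refl ∷ T⊆Δ , wδ<w , chain))

    tails-empty : ¬ (actB w δ <B w) → tails L ≡ []
    tails-empty wδ≮w with tails L | tails⊆ L
    ... | []    | _      = refl
    ... | T ∷ _ | ⊆L = ⊥-elim (wδ≮w (proj₁ (proj₂ (Equivalence.to (members (δ ∷ T)) (⊆L (here refl))))))

  exponent-bookkeeping : ∀ {e C C' ℓw ℓw' m} → e + suc C ≡ ℓw → ℓw ≡ ℓw' + suc (2 * m) → m + C' ≡ C → C' ≤ ℓw' →
    m ≤ e × (e ∸ m) + C' ≡ ℓw'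
  exponent-bookkeeping {e} {C} {C'} {ℓw} {ℓw'} {m} e+1+C≡ℓw ℓw≡ m+C'≡C C'≤ℓw' = m≤e , +-cancelˡ-≡ m _ _ (begin
    m + (e ∸ m + C')    ≡⟨ +-assoc m (e ∸ m) C' ⟨
    m + (e ∸ m) + C'    ≡⟨ cong (_+ C') (m+[n∸m]≡n m≤e) ⟩
    e + C'              ≡⟨ e+C'≡ℓw'+m ⟩
    ℓw' + m             ≡⟨ +-comm ℓw' m ⟩
    m + ℓw'             ∎)
    where
    open ≡-Reasoning
    e+C'≡ℓw'+m : e + C' ≡ ℓw' + m
    e+C'≡ℓw'+m = +-cancelʳ-≡ (suc m) _ _ (trans (sym (lhs e m C')) (trans (cong (λ z → e + suc z) m+C'≡C)
                   (trans e+1+C≡ℓw (trans ℓw≡ (rhs ℓw' m)))))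
      where
      lhs : ∀ e m C' → e + suc (m + C') ≡ (e + C') + suc m
      lhs = solve-∀
      rhs : ∀ ℓ m → ℓ + suc (2 * m) ≡ (ℓ + m) + suc m
      rhs = solve-∀
    m≤e : m ≤ e
    m≤e with ≤-<-connex m e
    ... | inj₁ m≤e = m≤e
    ... | inj₂ e<m = ⊥-elim (<-irrefl e+C'≡ℓw'+m (subst (e + C' <_) (+-comm m ℓw') (+-mono-<-≤ e<m C'≤ℓw')))

open Combinatorics
import Data.Nat.Properties as ℕₚ

module Evaluation {c ℓ} (R : CommutativeRing c ℓ) where
  open CommutativeRing R renaming (refl to ≈-refl; sym to ≈-sym; trans to ≈-trans; reflexive to ≈-reflexive)
  open Sum R
  open import Relation.Binary.Reasoning.Setoid (CommutativeRing.setoid R)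
  open import Algebra.Properties.CommutativeSemigroup +-commutativeSemigroup using () renaming (x∙yz≈y∙xz to x+yz≈y+xz)
  open import Algebra.Properties.CommutativeSemigroup *-commutativeSemigroup using (interchange; xy∙z≈xz∙y)

  t*z+z*[1-t]≈z : ∀ t z → t * z + z * (1# - t) ≈ z
  t*z+z*[1-t]≈z t z = begin
    t * z + z * (1# - t)     ≈⟨ +-congʳ (*-comm t z) ⟩
    z * t + z * (1# - t)     ≈⟨ distribˡ z t (1# - t) ⟨
    z * (t + (1# - t))       ≈⟨ *-congˡ t+[1-t]≈1 ⟩
    z * 1#                   ≈⟨ *-identityʳ z ⟩
    z                        ∎
    where
    t+[1-t]≈1 : t + (1# - t) ≈ 1#
    t+[1-t]≈1 = begin
      t + (1# - t)    ≈⟨ +-comm t (1# - t) ⟩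
      1# - t + t      ≈⟨ +-assoc 1# (- t) t ⟩
      1# + (- t + t)  ≈⟨ +-congˡ (-‿inverseˡ t) ⟩
      1# + 0#         ≈⟨ +-identityʳ 1# ⟩
      1#              ∎

  module _ (t : Carrier) {n} (w : Window n) (δ : BRefl n) where
    open Heads _≟ᴮ_ δ

    sumOver-split : ∀ L → sumOver t w L ≈ sumOver t w (others L) + sumOver t w (map (δ ∷_) (tails L))
    sumOver-split []            = ≈-sym (+-identityˡ 0#)
    sumOver-split ([] ∷ L)      = ≈-trans (+-congˡ (sumOver-split L)) (≈-sym (+-assoc _ _ _))
    sumOver-split ((x ∷ T) ∷ L) with x ≟ᴮ δ
    ... | yes refl = ≈-trans (+-congˡ (sumOver-split L)) (x+yz≈y+xz _ _ _)
    ... | no  _    = ≈-trans (+-congˡ (sumOver-split L)) (≈-sym (+-assoc _ _ _))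

    sumOver-factor : ∀ {w' : Window n} K L → All (λ T → term t w (δ ∷ T) ≈ K * term t w' T) L →
      sumOver t w (map (δ ∷_) L) ≈ K * sumOver t w' L
    sumOver-factor K []      []         = ≈-sym (zeroʳ K)
    sumOver-factor K (T ∷ L) (eq ∷ eqs) = ≈-trans (+-cong eq (sumOver-factor K L eqs)) (≈-sym (distribˡ K _ _))

  pow-+ : ∀ t m k → pow t (m ℕ.+ k) ≈ pow t m * pow t k
  pow-+ t zero    k = ≈-sym (*-identityˡ _)
  pow-+ t (suc m) k = ≈-trans (*-congˡ (pow-+ t m k)) (≈-sym (*-assoc _ _ _))

  GeneratingSum : ∀ {n} → List (BRefl n) → Set (c ⊔ ℓ)
  GeneratingSum {n} Δ = ∀ (w : Window n) → IsSignedPerm w →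
    (L : List (List (BRefl n))) → Unique L → (∀ T → T ∈ L ⇔ InA Δ w T) →
    ∀ t e → e ℕ.+ countBy (negInv w) Δ ≡ len w → sumOver t w L ≈ pow t e

  generating-sum-[] : ∀ {n} → GeneratingSum {n} []
  generating-sum-[] w _ L uniq members t e e+0≡len
    rewrite unique-singleton uniq (λ T → mk⇔ (λ T∈L → ⊆[]⇒≡[] (proj₁ (Equivalence.to (members T) T∈L))) (λ { refl → Equivalence.from (members []) ([] , _) })) = begin
      pow t (expo w []) * 1# + 0#   ≈⟨ +-identityʳ _ ⟩
      pow t (expo w []) * 1#        ≈⟨ *-identityʳ _ ⟩
      pow t (expo w [])             ≡⟨ cong (pow t) ([x+x]/2≡x (len w)) ⟩
      pow t (len w)                 ≡⟨ cong (pow t) (trans (sym e+0≡len) (ℕₚ.+-identityʳ e)) ⟩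
      pow t e                       ∎

  generating-sum-∷ : ∀ {n} {δ : BRefl n} {Δ} → IsFinalSegment (δ ∷ Δ) → GeneratingSum Δ → GeneratingSum (δ ∷ Δ)
  generating-sum-∷ {n} {i , j} {Δ} final IH w signed L uniq members t e e+count≡len with T? (negInv w (i , j))
  ... | yes a>b̄ = begin
    sumOver t w L                                               ≈⟨ sumOver-split t w (i , j) L ⟩
    sumOver t w (others L) + sumOver t w (map ((i , j) ∷_) (tails L))
      ≈⟨ +-cong below-others (sumOver-factor t w (i , j) K (tails L) (All.tabulate (λ T∈ → term-factor (chain T∈)))) ⟩
    t * pow t e + K * sumOver t w' (tails L)                    ≈⟨ +-congˡ (*-congˡ below-tails) ⟩
    t * pow t e + K * pow t (e ℕ.∸ m)                           ≈⟨ +-cong (*-congˡ pow-e) K-shift ⟩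
    t * Z + Z * (1# - t)                                        ≈⟨ t*z+z*[1-t]≈z t Z ⟩
    Z                                                           ≈⟨ pow-e ⟨
    pow t e                                                     ∎
    where
    open Split final w L members
    i≤j : toℕ i ℕ.≤ toℕ j
    i≤j = ℕₚ.≤-pred (ℕₚ.<ᵇ⇒< (toℕ i) (suc (toℕ j)) (All.head (IsFinalSegment.inside final)))
    w' = actBar w i j
    drop = length-drop w i j signed i≤j a>b̄
    m = proj₁ drop
    len-w = proj₁ (proj₂ drop)
    C = countBy (negInv w) Δ
    C' = countBy (negInv w') Δ
    m+C'≡C : m ℕ.+ C' ≡ C
    m+C'≡C = trans (cong (m ℕ.+_) (countBy-tail final w')) (trans (proj₂ (proj₂ drop)) (sym (countBy-tail final w)))
    e+1+C≡len : e ℕ.+ suc C ≡ len w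
    e+1+C≡len = trans (cong (e ℕ.+_) (sym (trans (countBy-∷ (negInv w) (i , j) Δ)
                                                  (cong (λ b → χ b ℕ.+ C) (Equivalence.to T-≡ a>b̄))))) e+count≡len
    C'≤len : C' ℕ.≤ len w'
    C'≤len = subst (ℕ._≤ len w') (sym (countBy-tail final w')) (Positions.segmentCount≤len i j w')
    bookkeeping = exponent-bookkeeping e+1+C≡len len-w m+C'≡C C'≤len
    below-others : sumOver t w (others L) ≈ t * pow t e
    below-others = IH w signed (others L) (Unique.filter⁺ _ uniq) others-members t (suc e)
                     (trans (sym (ℕₚ.+-suc e C)) e+1+C≡len)
    w'<w = actBar-below w i j signed i≤j a>b̄
    below-tails : sumOver t w' (tails L) ≈ pow t (e ℕ.∸ m)
    below-tails = IH w' (actBar-signed w i j signed) (tails L) (tails-unique L uniq) (tails-members w'<w) t (e ℕ.∸ m)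
                    (proj₂ bookkeeping)
    chain : ∀ {T} → T ∈ tails L → Chain w' T
    chain {T} T∈ = proj₂ (Equivalence.to (tails-members w'<w T) T∈)
    K = pow t m * (1# - t)
    term-factor : ∀ {T} → Chain w' T → term t w ((i , j) ∷ T) ≈ K * term t w' T
    term-factor {T} ch = ≈-trans (*-congʳ (≈-trans (≈-reflexive (cong (pow t) exponent)) (pow-+ t m _))) (interchange _ _ _ _)
      where
      exponent : expo w ((i , j) ∷ T) ≡ m ℕ.+ expo w' T
      exponent = exponent-step m (ℕₚ.≤-trans (ℕₚ.m≤m+n _ _) (chain-length w' T ch)) len-w
    Z = pow t m * pow t (e ℕ.∸ m)
    pow-e : pow t e ≈ Z
    pow-e = ≈-trans (≈-reflexive (cong (pow t) (sym (ℕₚ.m+[n∸m]≡n (proj₁ bookkeeping))))) (pow-+ t m (e ℕ.∸ m))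
    K-shift : K * pow t (e ℕ.∸ m) ≈ Z * (1# - t)
    K-shift = xy∙z≈xz∙y (pow t m) (1# - t) (pow t (e ℕ.∸ m))
  ... | no a≯b̄ = begin
    sumOver t w L                                               ≈⟨ sumOver-split t w (i , j) L ⟩
    sumOver t w (others L) + sumOver t w (map ((i , j) ∷_) (tails L))
      ≡⟨ cong (λ U → sumOver t w (others L) + sumOver t w (map ((i , j) ∷_) U)) (tails-empty w'≮w) ⟩
    sumOver t w (others L) + 0#                                 ≈⟨ +-identityʳ _ ⟩
    sumOver t w (others L)                                      ≈⟨ below-others ⟩
    pow t e                                                     ∎
    where
    open Split final w L members
    i≤j : toℕ i ℕ.≤ toℕ j
    i≤j = ℕₚ.≤-pred (ℕₚ.<ᵇ⇒< (toℕ i) (suc (toℕ j)) (All.head (IsFinalSegment.inside final)))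
    w'≮w = actBar-not-below w i j signed i≤j a≯b̄
    C = countBy (negInv w) Δ
    below-others : sumOver t w (others L) ≈ pow t e
    below-others = IH w signed (others L) (Unique.filter⁺ _ uniq) others-members t e
      (trans (cong (e ℕ.+_) (sym (trans (countBy-∷ (negInv w) (i , j) Δ)
                                        (cong (λ b → χ b ℕ.+ C) (Equivalence.to T-not-≡ (¬T⇒T-not a≯b̄)))))) e+count≡len)

  generating-sum : ∀ {n} {Δ : List (BRefl n)} → IsFinalSegment Δ → GeneratingSum Δ
  generating-sum {Δ = []}    _     = generating-sum-[]
  generating-sum {Δ = _ ∷ _} final = generating-sum-∷ final (generating-sum (tail-final final))

open import Data.Nat using (_≤_; _+_)

proposition7p3 : ∀ {c ℓ : Level} (R : CommutativeRing c ℓ) (n : ℕ) → 2 ≤ n →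
    (w : Window n) → IsSignedPerm w →
    ((i j : Fin n) → toℕ i ≤ toℕ j →
      (L : List (List (BRefl n))) → Unique L →
      (∀ T → (T ∈ L) ⇔ InA (Φseg n i j) w T) →
      (t : CommutativeRing.Carrier R) →
      CommutativeRing._≈_ R (Sum.sumOver R t w L) (Sum.pow R t (ℓ₊ w + ℓ₋ij i j w)))
    ×
    ((L : List (List (BRefl n))) → Unique L →
      (∀ T → (T ∈ L) ⇔ InA (Φ n) w T) →
      (t : CommutativeRing.Carrier R) →
      CommutativeRing._≈_ R (Sum.sumOver R t w L) (Sum.pow R t (ℓ₊ w)))
proposition7p3 R n _ w signed =
  (λ i j _ L uniq members t → generating-sum (Φseg-final n i j) w signed L uniq members t (ℓ₊ w + ℓ₋ij i j w)
     (trans (ℕₚ.+-assoc (ℓ₊ w) _ _) (cong (ℓ₊ w +_) (ℓ₋ij+countBy-Φseg i j w)))) ,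
  (λ L uniq members t → generating-sum (Φ-final n) w signed L uniq members t (ℓ₊ w)
     (cong (ℓ₊ w +_) (sym (ℓ₋≡countBy-Φ w))))
  where open Evaluation R using (generating-sum)
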